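{- For every variable vector $\vec x$ and every $\vec h\in\mathcal C^{\vec x}$ of bounded norm, the vector $\delta^{\vec x}\vec h$ is of bounded norm.
   Context: Ordinals: $\oplus,\otimes$ natural sum/product below $\varepsilon_0$; $2^\alpha:=\omega^{\alpha_0}2^k$ for $\alpha=\omega\alpha_0+k$; $\mathrm{no}(0)=0$, $\mathrm{no}(\omega^{\alpha_1}+\dots+\omega^{\alpha_k})=k+\sum_i\mathrm{no}(\alpha_i)$; $F_0(x)=2^x$, $F_{j+1}(x)=F_j^{x+1}(x)$, $\Phi(x)=F_5(x+100)$; $\psi(\alpha)=\max(\{0\}\cup\{\psi(\beta)+1:\beta<\alpha,\mathrm{no}(\beta)\le\Phi(\mathrm{no}(\alpha))\})$. Each typed variable $X^\sigma$ has a vector $\vec x=\langle x_0,\dots,x_{\mathrm{lv}(\sigma)}\rangle$ of distinct ordinal variables (disjoint for distinct variables). Ordinal terms: ordinal variables, $0,1,\omega$, $f+g$, $2^f\cdot g$, $\psi(\omega f+g)$; closed terms denote ordinals ($+$ as $\oplus$, $\cdot$ as $\otimes$). $x$-free: no $x_i$ occurs. Vectors: level-$n$ tuples, $h_i=0$ beyond level, componentwise sums, $2\vec v=\vec v+\vec v$, $\{\vec x:=\vec1\}$ replaces each $x_i$ by $1$, $\vec1=\langle1,\dots,1\rangle$. $\mathcal B_i$: $1\in\mathcal B_i$; $\omega\in\mathcal B_i$ ($i\ge1$); closed under $+$; $2^fg\in\mathcal B_i$ if $f\in\mathcal B_{i+1},g\in\mathcal B_i,i\ge1$; $\psi(\omega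 f+g)\in\mathcal B_0$ if $f\in\mathcal B_1,g\in\mathcal B_0,\mathrm{no}(f)\le F_2(g)$; $\mathcal B_0\subseteq\mathcal B_i$. Closed $\vec f$ bounded norm: $\mathrm{no}(f_i)\le\mathrm{no}(f_0)$. $f\preceq g$ (also for expressions with $\mathrm{no}$, $F_j$): holds under every substitution $\chi$ of the variable vectors occurring by vectors with $\chi(y_i)\in\mathcal B_i$ of bounded norm. A vector $\vec f$ is of bounded norm if $\mathrm{no}(f_i)\preceq\mathrm{no}(f_0)$ for all $i$. $\mathcal C^{\vec x}_i$: $1$; $\omega$ ($i\ge1$); $y^\rho_i$ for every variable $Y^\rho$, $i\le\mathrm{lv}(\rho)$; closed under $+$; $2^fg\in\mathcal C^{\vec x}_i$ if $f\in\mathcal C^{\vec x}_{i+1},g\in\mathcal C^{\vec x}_i,i\ge1$; $\psi(\omega f+g)\in\mathcal C^{\vec x}_0$ if $f\in\mathcal C^{\vec x}_1,g\in\mathcal C^{\vec x}_0,\mathrm{no}(f)\preceq F_2(g)$; $x$-free members of $\mathcal C^{\vec x}_0$ belong to all $\mathcal C^{\vec x}_i$. $\mathcal C^{\vec x}$: vectors with $h_i\in\mathcal C^{\vec x}_i$. $\delta^{\vec x}$ ($n:=\mathrm{lv}(\vec x)+1$): $\delta^{\vec x}_ih$ for $h\in\mathcal C^{\vec x}_i$ is a level-$n$ vector: $x$-free $h$: component $i$ is $h+1$, others $1$; $h\equiv x_i$: $\vec1$; $h\equiv f+g$: $\delta^{\vec x}_if+\delta^{\vec x}_ig+\vec1$;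 $h\equiv2^fg$ ($i>0$): $2\delta^{\vec x}_{i+1}f+\delta^{\vec x}_ig+\vec1$; $h\equiv\psi(\omega f+g)$ ($i=0$): component $0$ is $\psi(\omega f\{\vec x:=\vec1\}+(\delta^{\vec x}_0g)_0)$, component $j\ge1$ is $(\delta^{\vec x}_1f)_j+(\delta^{\vec x}_0g)_j$. $\mathrm{sz}^{\vec x}(h)=1$ if $x$-free or some $x_i$; $\mathrm{sz}^{\vec x}(f)+\mathrm{sz}^{\vec x}(g)+1$ for non-$x$-free $f+g$, $\psi(\omega f+g)$; $2\mathrm{sz}^{\vec x}(f)+\mathrm{sz}^{\vec x}(g)+1$ for non-$x$-free $2^fg$. For $\vec h\in\mathcal C^{\vec x}$ of level $m$: $\delta^{\vec x}\vec h$ of level $\max(n,m)$, $(\delta^{\vec x}\vec h)_0=2^n(\sum_{i\le m}\mathrm{sz}^{\vec x}(h_i))(\delta^{\vec x}_0h_0)_0$, $(\delta^{\vec x}\vec h)_j=\sum_{i\le m}(\delta^{\vec x}_ih_i)_j$ ($0<j\le n$), $=h_j$ ($j>n$). -}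

module Defs where

open import Data.Nat using (ℕ; zero; suc; _+_; _*_; _^_; _≤_; _⊔_)
open import Data.Nat.Properties using (_≟_)
open import Data.Bool using (Bool; true; false; if_then_else_; _∧_; _∨_; not)
open import Data.Fin using (Fin; toℕ) renaming (zero to fzero; suc to fsuc)
open import Data.Vec using (Vec; []; _∷_; lookup; tabulate; zipWith; replicate; head; foldr; allFin; map)
import Data.Vec as V
open import Data.Product using (Σ; _×_; _,_)
open import Data.Sum using (_⊎_)
open import Relation.Nullary using (¬_; does)
open import Relation.Binary.PropositionalEquality using (_≡_)
open import Function using (_∘_)

-- Ordinals below ε₀ in Cantor normal form  ω^a + b

infixr 6 ω^_+_
data Ord : Set where
  𝟎    : Ord
  ω^_+_ : Ord → Ord → Ord

infix 4 _<ₒ_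
data _<ₒ_ : Ord → Ord → Set where
  z<   : ∀ {a b} → 𝟎 <ₒ ω^ a + b
  exp< : ∀ {a b c d} → a <ₒ c → ω^ a + b <ₒ ω^ c + d
  tl<  : ∀ {a b d} → b <ₒ d → ω^ a + b <ₒ ω^ a + d

data NF : Ord → Set where
  nf0 : NF 𝟎
  nf1 : ∀ {a} → NF a → NF (ω^ a + 𝟎)
  nf2 : ∀ {a c d} → NF a → NF (ω^ c + d) → ¬ (a <ₒ c) → NF (ω^ a + (ω^ c + d))

data Cmp : Set where
  lt eq gt : Cmp

cmp : Ord → Ord → Cmp
cmp 𝟎 𝟎 = eq
cmp 𝟎 (ω^ _ + _) = lt
cmp (ω^ _ + _) 𝟎 = gt
cmp (ω^ a + b) (ω^ c + d) with cmp a c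
... | lt = lt
... | gt = gt
... | eq = cmp b d

-- natural (Hessenberg) sum
infixl 6 _⊕_
addL : Ord → Ord → (Ord → Ord) → Ord → Ord
addL a b rec 𝟎 = ω^ a + b
addL a b rec (ω^ c + d) with cmp a c
... | lt = ω^ c + addL a b rec d
... | eq = ω^ a + rec (ω^ c + d)
... | gt = ω^ a + rec (ω^ c + d)

_⊕_ : Ord → Ord → Ord
𝟎 ⊕ y = y
(ω^ a + b) ⊕ y = addL a b (λ z → b ⊕ z) y

-- natural product
mon⊗ : Ord → Ord → Ord
mon⊗ a 𝟎 = 𝟎
mon⊗ a (ω^ c + d) = ω^ (a ⊕ c) + mon⊗ a d

infixl 7 _⊗_
_⊗_ : Ord → Ord → Ord
𝟎 ⊗ y = 𝟎
(ω^ a + b) ⊗ y = mon⊗ a y ⊕ (b ⊗ y)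

rep : ℕ → Ord → Ord
rep zero x = 𝟎
rep (suc n) x = x ⊕ rep n x

fin : ℕ → Ord
fin n = rep n (ω^ 𝟎 + 𝟎)

ωₒ : Ord
ωₒ = ω^ fin 1 + 𝟎

-- the finite part of an ordinal (its value, if it is finite)
natVal : Ord → ℕ
natVal 𝟎 = 0
natVal (ω^ 𝟎 + b) = suc (natVal b)
natVal (ω^ (ω^ _ + _) + b) = natVal b

-- a' with 1 + a' = a, for a ≥ 1
predExp : Ord → Ord
predExp 𝟎 = 𝟎
predExp (ω^ 𝟎 + b) = b
predExp (ω^ (ω^ c + d) + b) = ω^ (ω^ c + d) + b

-- α = ω·α₀ + k
split : Ord → Σ Ord (λ _ → ℕ)
split 𝟎 = 𝟎 , 0
split (ω^ 𝟎 + b) with split b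
... | α₀ , k = α₀ , suc k
split (ω^ (ω^ c + d) + b) with split b
... | α₀ , k = ω^ (predExp (ω^ c + d)) + α₀ , k

-- 2^α := ω^{α₀} · 2^k  for α = ω·α₀ + k
2^ : Ord → Ord
2^ α with split α
... | α₀ , k = rep (2 ^ k) (ω^ α₀ + 𝟎)

no : Ord → ℕ
no 𝟎 = 0
no (ω^ a + b) = suc (no a + no b)

iter : ℕ → (ℕ → ℕ) → ℕ → ℕ
iter zero f x = x
iter (suc n) f x = f (iter n f x)

F : ℕ → ℕ → ℕ
F zero x = 2 ^ x
F (suc j) x = iter (suc x) (F j) x

Φ : ℕ → ℕ
Φ x = F 5 (x + 100)

-- ψ(α) = max({0} ∪ {ψ(β)+1 : β < α, no(β) ≤ Φ(no(α))}), β ranging over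
-- ordinals (< ε₀, i.e. Cantor normal forms).  This is a well-founded
-- recursion on ε₀; we state it as the defining specification of ψ.
IsPsi : (Ord → ℕ) → Set
IsPsi ψ = ∀ α → NF α →
    (∀ β → NF β → β <ₒ α → no β ≤ Φ (no α) → suc (ψ β) ≤ ψ α)
  × (ψ α ≡ 0 ⊎ Σ Ord (λ β → NF β × β <ₒ α × no β ≤ Φ (no α) × ψ α ≡ suc (ψ β)))

infixr 5 _⇒_
data Ty : Set where
  ι   : Ty
  _⇒_ : Ty → Ty → Ty

lv : Ty → ℕ
lv ι = 0
lv (ρ ⇒ τ) = suc (lv ρ) ⊔ lv τ

_==ᵗ_ : Ty → Ty → Bool
ι ==ᵗ ι = true
(a ⇒ b) ==ᵗ (c ⇒ d) = (a ==ᵗ c) ∧ (b ==ᵗ d)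
_ ==ᵗ _ = false

record Var : Set where
  constructor mkVar
  field
    name : ℕ
    ty   : Ty
open Var public

lvV : Var → ℕ
lvV X = lv (ty X)

_==ᵛ_ : Var → Var → Bool
X ==ᵛ Y = does (name X ≟ name Y) ∧ (ty X ==ᵗ ty Y)

-- Ordinal terms.  tvar Y i is the ordinal variable y_i of Y^ρ.
-- texp f g is 2^f·g,  tpsi f g is ψ(ω f + g).

data Term : Set where
  tvar   : Var → ℕ → Term
  tzero  : Term
  tone   : Term
  tomega : Term
  tplus  : Term → Term → Term
  texp   : Term → Term → Term
  tpsi   : Term → Term → Term

xfree : Var → Term → Bool
xfree X (tvar Y _) = not (X ==ᵛ Y)
xfree X tzero = true
xfree X tone = true
xfree X tomega = true
xfree X (tplus f g) = xfree X f ∧ xfree X g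
xfree X (texp f g) = xfree X f ∧ xfree X g
xfree X (tpsi f g) = xfree X f ∧ xfree X g

subst1 : Var → Term → Term
subst1 X (tvar Y i) = if X ==ᵛ Y then tone else tvar Y i
subst1 X tzero = tzero
subst1 X tone = tone
subst1 X tomega = tomega
subst1 X (tplus f g) = tplus (subst1 X f) (subst1 X g)
subst1 X (texp f g) = texp (subst1 X f) (subst1 X g)
subst1 X (tpsi f g) = tpsi (subst1 X f) (subst1 X g)

scale : ℕ → Term → Term
scale zero t = tzero
scale (suc c) t = tplus t (scale c t)

sumT : ∀ {k} → Vec Term k → Term
sumT = foldr _ tplus tzero

-- component of a vector, 0 beyond its level
get : ∀ {k} → Vec Term k → ℕ → Term
get [] _ = tzero
get (t ∷ _) zero = t
get (_ ∷ v) (suc j) = get v j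

module _ (ψ : Ord → ℕ) where

  ev : (Var → ℕ → Ord) → Term → Ord
  ev ρ (tvar Y i) = ρ Y i
  ev ρ tzero = 𝟎
  ev ρ tone = fin 1
  ev ρ tomega = ωₒ
  ev ρ (tplus f g) = ev ρ f ⊕ ev ρ g
  ev ρ (texp f g) = 2^ (ev ρ f) ⊗ ev ρ g
  ev ρ (tpsi f g) = fin (ψ (ωₒ ⊗ ev ρ f ⊕ ev ρ g))

  cev : Term → Ord
  cev = ev (λ _ _ → 𝟎)

  data B : ℕ → Term → Set where
    b1   : ∀ {i} → B i tone
    bω   : ∀ {i} → B (suc i) tomega
    b+   : ∀ {i f g} → B i f → B i g → B i (tplus f g)
    bexp : ∀ {i f g} → B (suc (suc i)) f → B (suc i) g → B (suc i) (texp f g)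
    bψ   : ∀ {f g} → B 1 f → B 0 g → no (cev f) ≤ F 2 (natVal (cev g)) → B 0 (tpsi f g)
    blift : ∀ {i f} → B 0 f → B i f

  Subst : Set
  Subst = Var → ℕ → Term

  Valid : Subst → Set
  Valid χ = ∀ Y i → i ≤ lvV Y →
    B i (χ Y i) × no (cev (χ Y i)) ≤ no (cev (χ Y 0))

  ⟦_⟧_ : Term → Subst → Ord
  ⟦ t ⟧ χ = ev (λ Y i → cev (χ Y i)) t

  data C (X : Var) : ℕ → Term → Set where
    c1   : ∀ {i} → C X i tone
    cω   : ∀ {i} → C X (suc i) tomega
    cvar : ∀ Y i → i ≤ lvV Y → C X i (tvar Y i)
    c+   : ∀ {i f g} → C X i f → C X i g → C X i (tplus f g)
    cexp : ∀ {i f g} → C X (suc (suc i)) f → C X (suc i) g → C X (suc i) (texp f g)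
    cψ   : ∀ {f g} → C X 1 f → C X 0 g →
           (∀ χ → Valid χ → no (⟦ f ⟧ χ) ≤ F 2 (natVal (⟦ g ⟧ χ))) →
           C X 0 (tpsi f g)
    clift : ∀ {i f} → C X 0 f → xfree X f ≡ true → C X i f

  InC : Var → ∀ {m} → Vec Term (suc m) → Set
  InC X h = ∀ (i : Fin _) → C X (toℕ i) (lookup h i)

  BoundedNorm : ∀ {k} → Vec Term (suc k) → Set
  BoundedNorm v = ∀ (i : Fin _) → ∀ χ → Valid χ →
    no (⟦ lookup v i ⟧ χ) ≤ no (⟦ lookup v fzero ⟧ χ)

-- n = lv(x⃗) + 1 ; level-n vectors have components 0..n
nX : Var → ℕ
nX X = suc (lvV X)

LVec : Var → Set
LVec X = Vec Term (suc (nX X))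

ones : ∀ {k} → Vec Term k
ones = replicate _ tone

_+ᵛ_ : ∀ {k} → Vec Term k → Vec Term k → Vec Term k
_+ᵛ_ = zipWith tplus

unitAt : ∀ {k} → ℕ → Term → Vec Term k
unitAt i t = tabulate (λ j → if does (toℕ j ≟ i) then t else tone)

δi : (X : Var) → ℕ → Term → LVec X
δi X i h@(tvar Y j) = if xfree X h then unitAt i (tplus h tone) else ones
δi X i tzero = unitAt i (tplus tzero tone)
δi X i tone = unitAt i (tplus tone tone)
δi X i tomega = unitAt i (tplus tomega tone)
δi X i h@(tplus f g) =
  if xfree X h then unitAt i (tplus h tone)
  else (δi X i f +ᵛ δi X i g) +ᵛ ones
δi X i h@(texp f g) =
  if xfree X h then unitAt i (tplus h tone)
  else ((δi X (suc i) f +ᵛ δi X (suc i) f) +ᵛ δi X i g) +ᵛ ones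
δi X i h@(tpsi f g) =
  if xfree X h then unitAt i (tplus h tone)
  else tabulate comp
  where
    comp : Fin (suc (nX X)) → Term
    comp fzero = tpsi (subst1 X f) (lookup (δi X 0 g) fzero)
    comp (fsuc j) = tplus (lookup (δi X 1 f) (fsuc j)) (lookup (δi X 0 g) (fsuc j))

sz : Var → Term → ℕ
sz X h@(tvar _ _) = 1
sz X tzero = 1
sz X tone = 1
sz X tomega = 1
sz X h@(tplus f g) = if xfree X h then 1 else sz X f + sz X g + 1
sz X h@(texp f g) = if xfree X h then 1 else 2 * sz X f + sz X g + 1
sz X h@(tpsi f g) = if xfree X h then 1 else sz X f + sz X g + 1

δvec : (X : Var) → ∀ {m} → Vec Term (suc m) → Vec Term (suc (nX X ⊔ m))
δvec X {m} h = tabulate (comp ∘ toℕ)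
  where
    idx : Vec (Fin (suc m)) (suc m)
    idx = allFin _
    szSum : ℕ
    szSum = V.sum (map (λ i → sz X (lookup h i)) idx)
    comp : ℕ → Term
    comp zero = scale (2 ^ nX X * szSum) (lookup (δi X 0 (lookup h fzero)) fzero)
    comp (suc j) =
      if does (suc j Data.Nat.≤? nX X)
      then sumT (map (λ i → get (δi X (toℕ i) (lookup h i)) (suc j)) idx)
      else get h (suc j)

-- Every component of δ^x h is x-free, so it can be evaluated under the substitution that
-- sets the variables of x to 1. There, by induction on 𝒞^x_i, the head (δ₀ h)₀ dominates h
-- both as an ordinal and in norm (ψ is monotone for this combination, and ψ α ≥ no α), while
-- for 1 ≤ j ≤ n the component (δ_i h)_j has norm at most w_i · sz(h) · no(h) with weights
-- w_i ≤ 2^n. Summing over the components of a vector h of bounded norm bounds each component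
-- j ≤ n of δ h by 2^n · Σ sz(h_i) · no(h₀) ≤ no((δ h)₀); the components beyond n are those of
-- h itself, which at such high levels are x-free and bounded by no(h₀).
module Submission where

open import Defs
open import Data.Nat using (ℕ; zero; suc; _+_; _*_; _^_; _≤_; _<_; _∸_; _≤?_; z≤n; s≤s; s<s; >-nonZero)
open import Data.Nat.Properties
open import Data.Nat.Tactic.RingSolver using (solve-∀)
open import Data.Bool using (true; false; if_then_else_; _∧_; not)
open import Data.Fin using (Fin; toℕ) renaming (zero to fzero; suc to fsuc)
open import Data.Vec using (Vec; []; _∷_; lookup; tabulate; zipWith; replicate; allFin; map)
import Data.Vec as V
open import Data.Vec.Properties using (lookup∘tabulate; lookup-zipWith; lookup-replicate)
open import Data.Product using (Σ; _×_; _,_; proj₁; proj₂)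
open import Data.Sum using (_⊎_; inj₁; inj₂)
open import Data.Empty using (⊥-elim)
open import Data.Unit using (⊤; tt)
open import Relation.Nullary using (¬_; Dec; does; _because_; ofʸ; ofⁿ)
open import Relation.Nullary.Decidable using (dec-true; dec-false)
open import Relation.Binary.PropositionalEquality
open import Relation.Binary.Definitions using (Monotonic₁)
open import Function using (_∘_)

-- Ordinals: the order and the natural sum

<ₒ-trans : ∀ {a b c} → a <ₒ b → b <ₒ c → a <ₒ c
<ₒ-trans z<       (exp< q) = z<
<ₒ-trans z<       (tl< q)  = z<
<ₒ-trans (exp< p) (exp< q) = exp< (<ₒ-trans p q)
<ₒ-trans (exp< p) (tl< q)  = exp< p
<ₒ-trans (tl< p)  (exp< q) = exp< q
<ₒ-trans (tl< p)  (tl< q)  = tl< (<ₒ-trans p q)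

<ₒ-irrefl : ∀ {a} → ¬ (a <ₒ a)
<ₒ-irrefl (exp< p) = <ₒ-irrefl p
<ₒ-irrefl (tl< p)  = <ₒ-irrefl p

<ₒ-asym : ∀ {a b} → a <ₒ b → ¬ (b <ₒ a)
<ₒ-asym p q = <ₒ-irrefl (<ₒ-trans p q)

infix 4 _≤ₒ_
_≤ₒ_ : Ord → Ord → Set
a ≤ₒ b = a <ₒ b ⊎ a ≡ b

≤ₒ-trans : ∀ {a b c} → a ≤ₒ b → b ≤ₒ c → a ≤ₒ c
≤ₒ-trans (inj₁ p)    (inj₁ q)    = inj₁ (<ₒ-trans p q)
≤ₒ-trans (inj₁ p)    (inj₂ refl) = inj₁ p
≤ₒ-trans (inj₂ refl) q           = q

data CmpView (a c : Ord) : Cmp → Set where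
  cmp-lt : a <ₒ c → CmpView a c lt
  cmp-eq : a ≡ c  → CmpView a c eq
  cmp-gt : c <ₒ a → CmpView a c gt

cmp-view : ∀ a c → CmpView a c (cmp a c)
cmp-view 𝟎          𝟎          = cmp-eq refl
cmp-view 𝟎          (ω^ _ + _) = cmp-lt z<
cmp-view (ω^ _ + _) 𝟎          = cmp-gt z<
cmp-view (ω^ a + b) (ω^ c + d) with cmp a c | cmp-view a c
... | lt | cmp-lt p = cmp-lt (exp< p)
... | gt | cmp-gt p = cmp-gt (exp< p)
... | eq | cmp-eq refl with cmp b d | cmp-view b d
...   | lt | cmp-lt q    = cmp-lt (tl< q)
...   | eq | cmp-eq refl = cmp-eq refl
...   | gt | cmp-gt q    = cmp-gt (tl< q)

<ₒ-trichotomy : ∀ a c → a <ₒ c ⊎ a ≡ c ⊎ c <ₒ a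
<ₒ-trichotomy a c with cmp a c | cmp-view a c
... | lt | cmp-lt p = inj₁ p
... | eq | cmp-eq p = inj₂ (inj₁ p)
... | gt | cmp-gt p = inj₂ (inj₂ p)

≮ₒ⇒≥ₒ : ∀ {a c} → ¬ (a <ₒ c) → c ≤ₒ a
≮ₒ⇒≥ₒ {a} {c} a≮c with <ₒ-trichotomy a c
... | inj₁ p        = ⊥-elim (a≮c p)
... | inj₂ (inj₁ p) = inj₂ (sym p)
... | inj₂ (inj₂ p) = inj₁ p

≤ₒ⇒≯ₒ : ∀ {a c} → c ≤ₒ a → ¬ (a <ₒ c)
≤ₒ⇒≯ₒ (inj₁ p)    q = <ₒ-asym p q
≤ₒ⇒≯ₒ (inj₂ refl) q = <ₒ-irrefl q

HeadBound : Ord → Ord → Set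
HeadBound a 𝟎          = ⊤
HeadBound a (ω^ c + d) = ¬ (a <ₒ c)

-- Cantor normal forms with the ordering condition stated uniformly for every tail;
-- equivalent to NF but easier to recurse on.
data CNF : Ord → Set where
  cnf-𝟎 : CNF 𝟎
  cnf-ω^ : ∀ {a b} → CNF a → CNF b → HeadBound a b → CNF (ω^ a + b)

CNF⇒NF : ∀ {a} → CNF a → NF a
CNF⇒NF cnf-𝟎                                 = nf0
CNF⇒NF (cnf-ω^ pa cnf-𝟎 _)                   = nf1 (CNF⇒NF pa)
CNF⇒NF (cnf-ω^ pa pb@(cnf-ω^ _ _ _) a≮c)     = nf2 (CNF⇒NF pa) (CNF⇒NF pb) a≮c

⊕-identityʳ : ∀ x → x ⊕ 𝟎 ≡ x
⊕-identityʳ 𝟎          = refl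
⊕-identityʳ (ω^ a + b) = refl

data ω^⊕ω^-View (a b c d : Ord) : Set where
  head-right : a <ₒ c →
    (ω^ a + b) ⊕ (ω^ c + d) ≡ ω^ c + ((ω^ a + b) ⊕ d) → ω^⊕ω^-View a b c d
  head-left : ¬ (a <ₒ c) →
    (ω^ a + b) ⊕ (ω^ c + d) ≡ ω^ a + (b ⊕ (ω^ c + d)) → ω^⊕ω^-View a b c d

ω^⊕ω^-view : ∀ a b c d → ω^⊕ω^-View a b c d
ω^⊕ω^-view a b c d with cmp a c in e | cmp-view a c
... | lt | cmp-lt p    = head-right p (unfold e)
  where
  unfold : cmp a c ≡ lt → addL a b (b ⊕_) (ω^ c + d) ≡ ω^ c + addL a b (b ⊕_) d
  unfold e with cmp a c
  unfold refl | lt = refl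
... | eq | cmp-eq refl = head-left <ₒ-irrefl (unfold e)
  where
  unfold : cmp a a ≡ eq → addL a b (b ⊕_) (ω^ a + d) ≡ ω^ a + (b ⊕ (ω^ a + d))
  unfold e with cmp a a
  unfold refl | eq = refl
... | gt | cmp-gt p    = head-left (<ₒ-asym p) (unfold e)
  where
  unfold : cmp a c ≡ gt → addL a b (b ⊕_) (ω^ c + d) ≡ ω^ a + (b ⊕ (ω^ c + d))
  unfold e with cmp a c
  unfold refl | gt = refl

ω^⊕ω^-< : ∀ {a b c d} → a <ₒ c → (ω^ a + b) ⊕ (ω^ c + d) ≡ ω^ c + ((ω^ a + b) ⊕ d)
ω^⊕ω^-< {a} {b} {c} {d} a<c with ω^⊕ω^-view a b c d
... | head-right _ e = e
... | head-left a≮c _ = ⊥-elim (a≮c a<c)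

ω^⊕-head : ∀ {a b} y → HeadBound a y → (ω^ a + b) ⊕ y ≡ ω^ a + (b ⊕ y)
ω^⊕-head {a} {b} 𝟎 _ = cong (ω^ a +_) (sym (⊕-identityʳ b))
ω^⊕-head {a} {b} (ω^ c + d) a≮c with ω^⊕ω^-view a b c d
... | head-right a<c _ = ⊥-elim (a≮c a<c)
... | head-left _ e    = e

no-⊕ : ∀ x y → no (x ⊕ y) ≡ no x + no y
no-⊕ 𝟎          y = refl
no-⊕ (ω^ a + b) y = go y
  where
  go : ∀ y → no ((ω^ a + b) ⊕ y) ≡ no (ω^ a + b) + no y
  go 𝟎 = sym (+-identityʳ _)
  go (ω^ c + d) with ω^⊕ω^-view a b c d
  ... | head-right _ e = begin
    no ((ω^ a + b) ⊕ (ω^ c + d))        ≡⟨ cong no e ⟩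
    suc (no c + no ((ω^ a + b) ⊕ d))    ≡⟨ cong (λ t → suc (no c + t)) (go d) ⟩
    suc (no c + (suc (no a + no b) + no d)) ≡⟨ rearrange (no a) (no b) (no c) (no d) ⟩
    suc (no a + no b) + suc (no c + no d) ∎
    where
    open ≡-Reasoning
    rearrange : ∀ p q r s → suc (r + (suc (p + q) + s)) ≡ suc (p + q) + suc (r + s)
    rearrange = solve-∀
  ... | head-left _ e = begin
    no ((ω^ a + b) ⊕ (ω^ c + d))        ≡⟨ cong no e ⟩
    suc (no a + no (b ⊕ (ω^ c + d)))    ≡⟨ cong (λ t → suc (no a + t)) (no-⊕ b (ω^ c + d)) ⟩
    suc (no a + (no b + no (ω^ c + d))) ≡⟨ cong suc (sym (+-assoc (no a) (no b) _)) ⟩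
    suc (no a + no b) + no (ω^ c + d) ∎
    where open ≡-Reasoning

HeadBound-⊕ : ∀ {e} x y → HeadBound e x → HeadBound e y → HeadBound e (x ⊕ y)
HeadBound-⊕ 𝟎          y          hx hy = hy
HeadBound-⊕ (ω^ a + b) 𝟎          hx hy = hx
HeadBound-⊕ (ω^ a + b) (ω^ c + d) hx hy with ω^⊕ω^-view a b c d
... | head-right _ e rewrite e = hy
... | head-left _ e  rewrite e = hx

CNF-⊕ : ∀ {x y} → CNF x → CNF y → CNF (x ⊕ y)
CNF-⊕ cnf-𝟎 py = py
CNF-⊕ {ω^ a + b} (cnf-ω^ pa pb hb) = go
  where
  go : ∀ {y} → CNF y → CNF ((ω^ a + b) ⊕ y)
  go cnf-𝟎 = cnf-ω^ pa pb hb
  go {ω^ c + d} (cnf-ω^ pc pd hd) with ω^⊕ω^-view a b c d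
  ... | head-right a<c e rewrite e = cnf-ω^ pc (go pd) (HeadBound-⊕ (ω^ a + b) d (<ₒ-asym a<c) hd)
  ... | head-left a≮c e  rewrite e = cnf-ω^ pa (CNF-⊕ pb (cnf-ω^ pc pd hd)) (HeadBound-⊕ b (ω^ c + d) hb a≮c)

⊕-monoʳ-< : ∀ {x y z} → CNF x → CNF y → CNF z → y <ₒ z → x ⊕ y <ₒ x ⊕ z
⊕-monoʳ-< cnf-𝟎 _ _ y<z = y<z
⊕-monoʳ-< {ω^ a + b} (cnf-ω^ pa pb hb) = go
  where
  go : ∀ {y z} → CNF y → CNF z → y <ₒ z → (ω^ a + b) ⊕ y <ₒ (ω^ a + b) ⊕ z
  go {𝟎} {ω^ e + f} cnf-𝟎 pz z< with ω^⊕ω^-view a b e f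
  ... | head-right a<e eqn rewrite eqn = exp< a<e
  ... | head-left _ eqn rewrite eqn =
    tl< (subst (_<ₒ b ⊕ (ω^ e + f)) (⊕-identityʳ b) (⊕-monoʳ-< pb cnf-𝟎 pz z<))
  go {ω^ c + d} {ω^ e + f} py@(cnf-ω^ _ pd _) pz@(cnf-ω^ _ pf _) y<z
    with ω^⊕ω^-view a b c d | ω^⊕ω^-view a b e f
  ... | head-right _ e₁ | head-right _ e₂ rewrite e₁ | e₂ = tails y<z
    where
    tails : ω^ c + d <ₒ ω^ e + f → ω^ c + ((ω^ a + b) ⊕ d) <ₒ ω^ e + ((ω^ a + b) ⊕ f)
    tails (exp< c<e) = exp< c<e
    tails (tl< d<f)  = tl< (go pd pf d<f)
  ... | head-right a<c _ | head-left a≮e _ = ⊥-elim (a≮e (lead y<z))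
    where
    lead : ω^ c + d <ₒ ω^ e + f → a <ₒ e
    lead (exp< c<e) = <ₒ-trans a<c c<e
    lead (tl< _)    = a<c
  ... | head-left _ e₁ | head-right a<e e₂ rewrite e₁ | e₂ = exp< a<e
  ... | head-left _ e₁ | head-left _ e₂   rewrite e₁ | e₂ = tl< (⊕-monoʳ-< pb py pz y<z)

⊕-monoʳ-≤ : ∀ {x y z} → CNF x → CNF y → CNF z → y ≤ₒ z → x ⊕ y ≤ₒ x ⊕ z
⊕-monoʳ-≤ px py pz (inj₁ y<z)  = inj₁ (⊕-monoʳ-< px py pz y<z)
⊕-monoʳ-≤ px py pz (inj₂ refl) = inj₂ refl

⊕-ω^-head : ∀ {a b d} → CNF d → HeadBound a d → HeadBound a b →
            d ⊕ (ω^ a + b) ≡ ω^ a + (d ⊕ b)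
⊕-ω^-head cnf-𝟎 _ _ = refl
⊕-ω^-head {a} {b} {ω^ e + f} (cnf-ω^ _ pf hf) a≮e hb with ω^⊕ω^-view e f a b
... | head-right _ eqn = eqn
... | head-left e≮a eqn with <ₒ-trichotomy a e
...   | inj₁ a<e        = ⊥-elim (a≮e a<e)
...   | inj₂ (inj₂ e<a) = ⊥-elim (e≮a e<a)
...   | inj₂ (inj₁ refl) = begin
  (ω^ a + f) ⊕ (ω^ a + b)   ≡⟨ eqn ⟩
  ω^ a + (f ⊕ (ω^ a + b))   ≡⟨ cong (ω^ a +_) (⊕-ω^-head pf hf hb) ⟩
  ω^ a + (ω^ a + (f ⊕ b))   ≡⟨ cong (ω^ a +_) (sym (ω^⊕-head b hb)) ⟩
  ω^ a + ((ω^ a + f) ⊕ b)   ∎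
  where open ≡-Reasoning

⊕-comm : ∀ {x y} → CNF x → CNF y → x ⊕ y ≡ y ⊕ x
⊕-comm {y = y} cnf-𝟎 _ = sym (⊕-identityʳ y)
⊕-comm {ω^ a + b} (cnf-ω^ pa pb hb) = go
  where
  go : ∀ {y} → CNF y → (ω^ a + b) ⊕ y ≡ y ⊕ (ω^ a + b)
  go cnf-𝟎 = refl
  go {ω^ c + d} py@(cnf-ω^ _ pd hd) with <ₒ-trichotomy a c
  ... | inj₁ a<c = begin
    (ω^ a + b) ⊕ (ω^ c + d)   ≡⟨ ω^⊕ω^-< a<c ⟩
    ω^ c + ((ω^ a + b) ⊕ d)   ≡⟨ cong (ω^ c +_) (go pd) ⟩
    ω^ c + (d ⊕ (ω^ a + b))   ≡⟨ sym (ω^⊕-head (ω^ a + b) (<ₒ-asym a<c)) ⟩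
    (ω^ c + d) ⊕ (ω^ a + b)   ∎
    where open ≡-Reasoning
  ... | inj₂ (inj₂ c<a) = begin
    (ω^ a + b) ⊕ (ω^ c + d)   ≡⟨ ω^⊕-head (ω^ c + d) (<ₒ-asym c<a) ⟩
    ω^ a + (b ⊕ (ω^ c + d))   ≡⟨ cong (ω^ a +_) (⊕-comm pb py) ⟩
    ω^ a + ((ω^ c + d) ⊕ b)   ≡⟨ sym (ω^⊕ω^-< c<a) ⟩
    (ω^ c + d) ⊕ (ω^ a + b)   ∎
    where open ≡-Reasoning
  ... | inj₂ (inj₁ refl) = begin
    (ω^ a + b) ⊕ (ω^ a + d)   ≡⟨ ω^⊕-head (ω^ a + d) <ₒ-irrefl ⟩
    ω^ a + (b ⊕ (ω^ a + d))   ≡⟨ cong (ω^ a +_) (⊕-ω^-head pb hb hd) ⟩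
    ω^ a + (ω^ a + (b ⊕ d))   ≡⟨ cong (λ t → ω^ a + (ω^ a + t)) (⊕-comm pb pd) ⟩
    ω^ a + (ω^ a + (d ⊕ b))   ≡⟨ cong (ω^ a +_) (sym (⊕-ω^-head pd hd hb)) ⟩
    ω^ a + (d ⊕ (ω^ a + b))   ≡⟨ sym (ω^⊕-head (ω^ a + b) <ₒ-irrefl) ⟩
    (ω^ a + d) ⊕ (ω^ a + b)   ∎
    where open ≡-Reasoning

⊕-monoˡ-≤ : ∀ {x y z} → CNF x → CNF y → CNF z → x ≤ₒ y → x ⊕ z ≤ₒ y ⊕ z
⊕-monoˡ-≤ {x} {y} {z} px py pz x≤y
  rewrite ⊕-comm px pz | ⊕-comm py pz = ⊕-monoʳ-≤ pz px py x≤y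

infix 4 _≼_
_≼_ : Ord → Ord → Set
a ≼ b = a ≤ₒ b × no a ≤ no b

≼-refl : ∀ {a} → a ≼ a
≼-refl = inj₂ refl , ≤-refl

≼-trans : ∀ {a b c} → a ≼ b → b ≼ c → a ≼ c
≼-trans (a≤b , na≤nb) (b≤c , nb≤nc) = ≤ₒ-trans a≤b b≤c , ≤-trans na≤nb nb≤nc

≼-⊕ʳ : ∀ {x y} → CNF x → CNF y → x ≼ x ⊕ y
≼-⊕ʳ {x} {y} px py =
  subst (_≤ₒ x ⊕ y) (⊕-identityʳ x) (⊕-monoʳ-≤ px cnf-𝟎 py (𝟎≤ₒ py)) ,
  ≤-trans (m≤m+n (no x) (no y)) (≤-reflexive (sym (no-⊕ x y)))
  where
  𝟎≤ₒ : ∀ {y} → CNF y → 𝟎 ≤ₒ y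
  𝟎≤ₒ cnf-𝟎 = inj₂ refl
  𝟎≤ₒ (cnf-ω^ _ _ _) = inj₁ z<

⊕-mono-≼ : ∀ {x x' y y'} → CNF x → CNF x' → CNF y → CNF y' → x ≼ x' → y ≼ y' → x ⊕ y ≼ x' ⊕ y'
⊕-mono-≼ {x} {x'} {y} {y'} px px' py py' (x≤x' , nx≤nx') (y≤y' , ny≤ny') =
  ≤ₒ-trans (⊕-monoʳ-≤ px py py' y≤y') (⊕-monoˡ-≤ px px' py' x≤x') ,
  subst₂ _≤_ (sym (no-⊕ x y)) (sym (no-⊕ x' y')) (+-mono-≤ nx≤nx' ny≤ny')

-- Finite multiples, natural products and 2^

no-rep : ∀ n x → no (rep n x) ≡ n * no x
no-rep zero    x = refl
no-rep (suc n) x = trans (no-⊕ x (rep n x)) (cong (no x +_) (no-rep n x))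

no-fin : ∀ n → no (fin n) ≡ n
no-fin n = trans (no-rep n _) (*-identityʳ n)

CNF-rep : ∀ n {x} → CNF x → CNF (rep n x)
CNF-rep zero    px = cnf-𝟎
CNF-rep (suc n) px = CNF-⊕ px (CNF-rep n px)

CNF-fin : ∀ n → CNF (fin n)
CNF-fin n = CNF-rep n (cnf-ω^ cnf-𝟎 cnf-𝟎 tt)

CNF-ω : CNF ωₒ
CNF-ω = cnf-ω^ (CNF-fin 1) cnf-𝟎 tt

fin-suc : ∀ n → fin (suc n) ≡ ω^ 𝟎 + fin n
fin-suc zero = refl
fin-suc (suc n) rewrite fin-suc n = refl

fin-mono : ∀ {m n} → m ≤ n → fin m ≤ₒ fin n
fin-mono {zero}  {zero}  _ = inj₂ refl
fin-mono {zero}  {suc n} _ rewrite fin-suc n = inj₁ z<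
fin-mono {suc m} {suc n} (s≤s m≤n) rewrite fin-suc m | fin-suc n with fin-mono m≤n
... | inj₁ p = inj₁ (tl< p)
... | inj₂ p = inj₂ (cong (ω^ 𝟎 +_) p)

fin-mono-≼ : ∀ {m n} → m ≤ n → fin m ≼ fin n
fin-mono-≼ {m} {n} m≤n = fin-mono m≤n , subst₂ _≤_ (sym (no-fin m)) (sym (no-fin n)) m≤n

HeadBound-mon⊗ : ∀ {a c y} → CNF a → CNF c → CNF y → HeadBound c y → HeadBound (a ⊕ c) (mon⊗ a y)
HeadBound-mon⊗ {y = 𝟎} _ _ _ _ = tt
HeadBound-mon⊗ pa pc (cnf-ω^ pc' _ _) c≮c' =
  ≤ₒ⇒≯ₒ (⊕-monoʳ-≤ pa pc' pc (≮ₒ⇒≥ₒ c≮c'))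

CNF-mon⊗ : ∀ {a y} → CNF a → CNF y → CNF (mon⊗ a y)
CNF-mon⊗ pa cnf-𝟎 = cnf-𝟎
CNF-mon⊗ pa (cnf-ω^ pc pd hd) = cnf-ω^ (CNF-⊕ pa pc) (CNF-mon⊗ pa pd) (HeadBound-mon⊗ pa pc pd hd)

CNF-⊗ : ∀ {x y} → CNF x → CNF y → CNF (x ⊗ y)
CNF-⊗ cnf-𝟎 py = cnf-𝟎
CNF-⊗ (cnf-ω^ pa pb _) py = CNF-⊕ (CNF-mon⊗ pa py) (CNF-⊗ pb py)

no-mon⊗-≥ʳ : ∀ a y → no y ≤ no (mon⊗ a y)
no-mon⊗-≥ʳ a 𝟎          = z≤n
no-mon⊗-≥ʳ a (ω^ c + d) =
  s≤s (+-mono-≤ (subst (no c ≤_) (sym (no-⊕ a c)) (m≤n+m (no c) (no a))) (no-mon⊗-≥ʳ a d))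

no-mon⊗-≥ˡ : ∀ a c d → suc (no a) ≤ no (mon⊗ a (ω^ c + d))
no-mon⊗-≥ˡ a c d =
  s≤s (≤-trans (subst (no a ≤_) (sym (no-⊕ a c)) (m≤m+n (no a) (no c))) (m≤m+n _ _))

no-⊗-≥ˡ : ∀ x y → 0 < no y → no x ≤ no (x ⊗ y)
no-⊗-≥ˡ 𝟎          y          _ = z≤n
no-⊗-≥ˡ (ω^ a + b) (ω^ c + d) p = subst (suc (no a + no b) ≤_) (sym (no-⊕ (mon⊗ a _) (b ⊗ _)))
  (+-mono-≤ (no-mon⊗-≥ˡ a c d) (no-⊗-≥ˡ b (ω^ c + d) p))

no-⊗-≥ʳ : ∀ x y → 0 < no x → no y ≤ no (x ⊗ y)
no-⊗-≥ʳ (ω^ a + b) y _ = subst (no y ≤_) (sym (no-⊕ (mon⊗ a y) (b ⊗ y)))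
  (≤-trans (no-mon⊗-≥ʳ a y) (m≤m+n _ _))

CNF-predExp : ∀ {u} → CNF u → CNF (predExp u)
CNF-predExp cnf-𝟎 = cnf-𝟎
CNF-predExp {ω^ 𝟎 + d} (cnf-ω^ _ pd _) = pd
CNF-predExp {ω^ (ω^ _ + _) + _} pu = pu

predExp-mono : ∀ e {c d} → CNF (ω^ c + d) → ¬ (e <ₒ ω^ c + d) → ¬ (predExp e <ₒ predExp (ω^ c + d))
predExp-mono 𝟎                    {c}          _ e≮u _ = e≮u z<
predExp-mono (ω^ 𝟎 + _)           {𝟎}          _ e≮u q = e≮u (tl< q)
predExp-mono (ω^ (ω^ x + y) + _)  {𝟎}          (cnf-ω^ _ _ hd) _ = finite-tail hd
  where
  finite-tail : ∀ {d e} → HeadBound 𝟎 d → ¬ (ω^ (ω^ x + y) + e <ₒ d)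
  finite-tail {ω^ 𝟎 + _}          _  (exp< ())
  finite-tail {ω^ (ω^ _ + _) + _} hd _ = hd z<
predExp-mono (ω^ 𝟎 + _)           {ω^ _ + _}   _ e≮u q = e≮u (exp< z<)
predExp-mono (ω^ (ω^ _ + _) + _)  {ω^ _ + _}   _ e≮u q = e≮u q

HeadBound-𝟎 : ∀ {e b} → HeadBound 𝟎 b → HeadBound e b
HeadBound-𝟎 {b = 𝟎}                  _ = tt
HeadBound-𝟎 {b = ω^ 𝟎 + _}           _ ()
HeadBound-𝟎 {b = ω^ (ω^ _ + _) + _} h _ = h z<

HeadBound-split : ∀ {x} e → CNF x → HeadBound e x → HeadBound (predExp e) (proj₁ (split x))
HeadBound-split e cnf-𝟎 _ = tt
HeadBound-split e (cnf-ω^ {𝟎} {b} _ pb hb) _ with split b | HeadBound-split e pb (HeadBound-𝟎 hb)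
... | _ , _ | ih = ih
HeadBound-split e (cnf-ω^ {ω^ c + d} {b} pu _ _) e≮u with split b
... | _ , _ = predExp-mono e pu e≮u

CNF-split : ∀ {x} → CNF x → CNF (proj₁ (split x))
CNF-split cnf-𝟎 = cnf-𝟎
CNF-split (cnf-ω^ {𝟎} {b} _ pb _) with split b | CNF-split pb
... | _ , _ | ih = ih
CNF-split (cnf-ω^ {ω^ c + d} {b} pu pb hb) with split b | CNF-split pb | HeadBound-split (ω^ c + d) pb hb
... | _ , _ | ih | h = cnf-ω^ (CNF-predExp pu) ih h

CNF-2^ : ∀ {x} → CNF x → CNF (2^ x)
CNF-2^ {x} px with split x | CNF-split px
... | α₀ , k | pα₀ = CNF-rep (2 ^ k) (cnf-ω^ pα₀ cnf-𝟎 tt)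

n≤2^n : ∀ n → n ≤ 2 ^ n
n≤2^n zero    = z≤n
n≤2^n (suc n) = begin
  suc n         ≡⟨ +-comm 1 n ⟩
  n + 1         ≤⟨ +-mono-≤ (n≤2^n n) (m^n>0 2 n) ⟩
  2 ^ n + 2 ^ n ≡⟨ cong (2 ^ n +_) (sym (+-identityʳ _)) ⟩
  2 ^ suc n     ∎
  where open ≤-Reasoning

no-split : ∀ x → no x ≤ 2 * no (proj₁ (split x)) + proj₂ (split x)
no-split 𝟎 = z≤n
no-split (ω^ 𝟎 + b) with split b | no-split b
... | _ , k | ih = subst (suc (no b) ≤_) (sym (+-suc _ k)) (s≤s ih)
no-split (ω^ (ω^ c + d) + b) with split b | no-split b
... | α₀ , k | ih = begin
  suc (no (ω^ c + d) + no b)  ≤⟨ s≤s (+-mono-≤ (no-predExp c d) ih) ⟩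
  suc (suc p + (2 * q + k))     ≤⟨ m≤m+n _ p ⟩
  suc (suc p + (2 * q + k)) + p ≡⟨ rearrange p q k ⟩
  2 * suc (p + q) + k           ∎
  where
  open ≤-Reasoning
  p = no (predExp (ω^ c + d))
  q = no α₀
  no-predExp : ∀ c d → no (ω^ c + d) ≤ suc (no (predExp (ω^ c + d)))
  no-predExp 𝟎          d = ≤-refl
  no-predExp (ω^ _ + _) d = n≤1+n _
  rearrange : ∀ p q k → suc (suc p + (2 * q + k)) + p ≡ 2 * suc (p + q) + k
  rearrange = solve-∀

no-2^-pos : ∀ x → 0 < no (2^ x)
no-2^-pos x with split x
... | α₀ , k rewrite no-rep (2 ^ k) (ω^ α₀ + 𝟎) =
  ≤-trans (s≤s z≤n) (m≤n*m (suc (no α₀ + 0)) (2 ^ k) {{>-nonZero (m^n>0 2 k)}})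

no≤2*no-2^ : ∀ x → no x ≤ 2 * no (2^ x)
no≤2*no-2^ x with split x | no-split x
... | α₀ , k | ih rewrite no-rep (2 ^ k) (ω^ α₀ + 𝟎) = begin
  no x                               ≤⟨ ih ⟩
  2 * q + k
    ≤⟨ +-mono-≤ (*-monoʳ-≤ 2 (m≤n*m q (2 ^ k) {{>-nonZero (m^n>0 2 k)}})) (n≤2^n k) ⟩
  2 * (2 ^ k * q) + 2 ^ k            ≤⟨ +-monoʳ-≤ (2 * (2 ^ k * q)) (m≤m*n (2 ^ k) 2) ⟩
  2 * (2 ^ k * q) + 2 ^ k * 2        ≡⟨ rearrange q (2 ^ k) ⟩
  2 * (2 ^ k * suc (q + 0))          ∎
  where
  open ≤-Reasoning
  q = no α₀
  rearrange : ∀ q t → 2 * (t * q) + t * 2 ≡ 2 * (t * suc (q + 0))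
  rearrange = solve-∀

-- The fast-growing hierarchy and ψ

Inflationary : (ℕ → ℕ) → Set
Inflationary f = ∀ x → x ≤ f x

iter-mono : ∀ {f} → Monotonic₁ _≤_ _≤_ f → ∀ n → Monotonic₁ _≤_ _≤_ (iter n f)
iter-mono f-mono zero    x≤y = x≤y
iter-mono f-mono (suc n) x≤y = f-mono (iter-mono f-mono n x≤y)

iter-inflationary : ∀ {f} → Inflationary f → ∀ n → Inflationary (iter n f)
iter-inflationary f-infl zero    x = ≤-refl
iter-inflationary f-infl (suc n) x = ≤-trans (iter-inflationary f-infl n x) (f-infl _)

iter-monoˡ : ∀ {f} → Monotonic₁ _≤_ _≤_ f → Inflationary f →
             ∀ {m n} x → m ≤ n → iter m f x ≤ iter n f x
iter-monoˡ f-mono f-infl {zero}  {n}     x _         = iter-inflationary f-infl n x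
iter-monoˡ f-mono f-infl {suc m} {suc n} x (s≤s m≤n) = f-mono (iter-monoˡ f-mono f-infl x m≤n)

F-mono×inflationary : ∀ j → Monotonic₁ _≤_ _≤_ (F j) × Inflationary (F j)
F-mono×inflationary zero = ^-monoʳ-≤ 2 , n≤2^n
F-mono×inflationary (suc j) with F-mono×inflationary j
... | mono , infl =
  (λ {x} {y} x≤y → ≤-trans (iter-mono mono (suc x) x≤y) (iter-monoˡ mono infl y (s≤s x≤y))) ,
  (λ x → iter-inflationary infl (suc x) x)

Φ-mono : Monotonic₁ _≤_ _≤_ Φ
Φ-mono x≤y = proj₁ (F-mono×inflationary 5) (+-monoˡ-≤ 100 x≤y)

Φ-inflationary : Inflationary Φ
Φ-inflationary x = ≤-trans (m≤m+n x 100) (proj₂ (F-mono×inflationary 5) (x + 100))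

record NormPredecessor (α : Ord) : Set where
  field
    pred      : Ord
    cnf       : CNF pred
    pred<     : pred <ₒ α
    no-pred   : suc (no pred) ≡ no α
    headBound : ∀ e → HeadBound e α → HeadBound e pred

normPredecessor : ∀ {a b} → CNF (ω^ a + b) → NormPredecessor (ω^ a + b)
normPredecessor {𝟎} {𝟎} _ = record
  { pred = 𝟎 ; cnf = cnf-𝟎 ; pred< = z< ; no-pred = refl ; headBound = λ _ _ → tt }
normPredecessor {ω^ c + d} {𝟎} (cnf-ω^ pa _ _) = record
  { pred      = ω^ pred + 𝟎
  ; cnf       = cnf-ω^ cnf cnf-𝟎 tt
  ; pred<     = exp< pred<
  ; no-pred   = cong suc (trans (cong suc (+-identityʳ _)) (trans no-pred (sym (+-identityʳ _))))
  ; headBound = λ e e≮a e<a' → e≮a (<ₒ-trans e<a' pred<)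
  }
  where open NormPredecessor (normPredecessor pa)
normPredecessor {a} {ω^ c + d} (cnf-ω^ pa pb hb) = record
  { pred      = ω^ a + pred
  ; cnf       = cnf-ω^ pa cnf (headBound a hb)
  ; pred<     = tl< pred<
  ; no-pred   = cong suc (trans (sym (+-suc _ _)) (cong (no a +_) no-pred))
  ; headBound = λ _ h → h
  }
  where open NormPredecessor (normPredecessor pb)

module PsiProperties (ψ : Ord → ℕ) (isψ : IsPsi ψ) where

  ψ-step : ∀ {α β} → CNF α → CNF β → β <ₒ α → no β ≤ no α → suc (ψ β) ≤ ψ α
  ψ-step {α} pα pβ β<α noβ≤noα =
    proj₁ (isψ α (CNF⇒NF pα)) _ (CNF⇒NF pβ) β<α (≤-trans noβ≤noα (Φ-inflationary (no α)))

  -- Descend from α through predecessors of norm one less; ψ grows by at least one per step.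
  no≤ψ : ∀ {α} → CNF α → no α ≤ ψ α
  no≤ψ = go _ ≤-refl
    where
    go : ∀ n {α} → no α ≤ n → CNF α → no α ≤ ψ α
    go _       {𝟎}        _        _  = z≤n
    go zero    {ω^ _ + _} ()       _
    go (suc n) {ω^ a + b} (s≤s le) pα = begin
      no (ω^ a + b)  ≡⟨ sym no-pred ⟩
      suc (no pred)  ≤⟨ s≤s (go n (≤-trans (≤-reflexive (suc-injective no-pred)) le) cnf) ⟩
      suc (ψ pred)   ≤⟨ ψ-step pα cnf pred< (≤-trans (n≤1+n _) (≤-reflexive no-pred)) ⟩
      ψ (ω^ a + b)   ∎
      where
      open ≤-Reasoning
      open NormPredecessor (normPredecessor pα)

  -- ψ α is attained at some β < α, which then also lies below α' within the norm bound of α'.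
  ψ-mono : ∀ {α α'} → CNF α → CNF α' → α ≼ α' → ψ α ≤ ψ α'
  ψ-mono _ _ (inj₂ refl , _) = ≤-refl
  ψ-mono {α} {α'} pα pα' (inj₁ α<α' , noα≤noα') with proj₂ (isψ α (CNF⇒NF pα))
  ... | inj₁ ψα≡0 = subst (_≤ ψ α') (sym ψα≡0) z≤n
  ... | inj₂ (β , nfβ , β<α , noβ≤Φ , ψα≡) = subst (_≤ ψ α') (sym ψα≡)
    (proj₁ (isψ α' (CNF⇒NF pα')) β nfβ (<ₒ-trans β<α α<α') (≤-trans noβ≤Φ (Φ-mono noα≤noα')))

-- Terms and their semantics

∧-true-elim : ∀ {a b} → a ∧ b ≡ true → a ≡ true × b ≡ true
∧-true-elim {true} {true} _ = refl , refl

∧-false-elim : ∀ {a b} → a ∧ b ≡ false → a ≡ false ⊎ b ≡ false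
∧-false-elim {false}         _ = inj₁ refl
∧-false-elim {true}  {false} _ = inj₂ refl

∧-true-intro : ∀ {a b} → a ≡ true → b ≡ true → a ∧ b ≡ true
∧-true-intro refl refl = refl

not-true-elim : ∀ {a} → not a ≡ true → a ≡ false
not-true-elim {false} _ = refl

not-false-elim : ∀ {a} → not a ≡ false → a ≡ true
not-false-elim {true} _ = refl

true≢false : true ≢ false
true≢false ()

==ᵗ⇒≡ : ∀ a b → (a ==ᵗ b) ≡ true → a ≡ b
==ᵗ⇒≡ ι       ι       _ = refl
==ᵗ⇒≡ (a ⇒ b) (c ⇒ d) e with ∧-true-elim {a ==ᵗ c} e
... | e₁ , e₂ = cong₂ _⇒_ (==ᵗ⇒≡ a c e₁) (==ᵗ⇒≡ b d e₂)

==ᵛ⇒lvV≡ : ∀ X Y → (X ==ᵛ Y) ≡ true → lvV X ≡ lvV Y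
==ᵛ⇒lvV≡ X Y e = cong lv (==ᵗ⇒≡ (ty X) (ty Y) (proj₂ (∧-true-elim {does (name X ≟ name Y)} e)))

xfree-subst1 : ∀ X t → xfree X (subst1 X t) ≡ true
xfree-subst1 X (tvar Y i) with X ==ᵛ Y in e
... | true  = refl
... | false rewrite e = refl
xfree-subst1 X tzero       = refl
xfree-subst1 X tone        = refl
xfree-subst1 X tomega      = refl
xfree-subst1 X (tplus f g) = ∧-true-intro (xfree-subst1 X f) (xfree-subst1 X g)
xfree-subst1 X (texp f g)  = ∧-true-intro (xfree-subst1 X f) (xfree-subst1 X g)
xfree-subst1 X (tpsi f g)  = ∧-true-intro (xfree-subst1 X f) (xfree-subst1 X g)

module Semantics (ψ : Ord → ℕ) where

  infix 10 ⟦_⟧ᵒ_ ‖_‖_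
  ⟦_⟧ᵒ_ : Term → Subst ψ → Ord
  ⟦ t ⟧ᵒ χ = ⟦_⟧_ ψ t χ

  ‖_‖_ : Term → Subst ψ → ℕ
  ‖ t ‖ χ = no (⟦ t ⟧ᵒ χ)

  CNF-ev : ∀ {ρ} → (∀ Y i → CNF (ρ Y i)) → ∀ t → CNF (ev ψ ρ t)
  CNF-ev cnfρ (tvar Y i)  = cnfρ Y i
  CNF-ev cnfρ tzero       = cnf-𝟎
  CNF-ev cnfρ tone        = CNF-fin 1
  CNF-ev cnfρ tomega      = CNF-ω
  CNF-ev cnfρ (tplus f g) = CNF-⊕ (CNF-ev cnfρ f) (CNF-ev cnfρ g)
  CNF-ev cnfρ (texp f g)  = CNF-⊗ (CNF-2^ (CNF-ev cnfρ f)) (CNF-ev cnfρ g)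
  CNF-ev {ρ} cnfρ (tpsi f g) = CNF-fin (ψ (ωₒ ⊗ ev ψ ρ f ⊕ ev ψ ρ g))

  CNF-⟦⟧ : ∀ t χ → CNF (⟦ t ⟧ᵒ χ)
  CNF-⟦⟧ t χ = CNF-ev (λ Y i → CNF-ev (λ _ _ → cnf-𝟎) (χ Y i)) t

  ev-cong-xfree : ∀ X {ρ ρ'} → (∀ Y i → (X ==ᵛ Y) ≡ false → ρ Y i ≡ ρ' Y i) →
                  ∀ t → xfree X t ≡ true → ev ψ ρ t ≡ ev ψ ρ' t
  ev-cong-xfree X ρ≗ρ' (tvar Y i) e = ρ≗ρ' Y i (not-true-elim e)
  ev-cong-xfree X ρ≗ρ' tzero       e = refl
  ev-cong-xfree X ρ≗ρ' tone        e = refl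
  ev-cong-xfree X ρ≗ρ' tomega      e = refl
  ev-cong-xfree X ρ≗ρ' (tplus f g) e with ∧-true-elim {xfree X f} e
  ... | e₁ , e₂ = cong₂ _⊕_ (ev-cong-xfree X ρ≗ρ' f e₁) (ev-cong-xfree X ρ≗ρ' g e₂)
  ev-cong-xfree X ρ≗ρ' (texp f g)  e with ∧-true-elim {xfree X f} e
  ... | e₁ , e₂ = cong₂ (λ u v → 2^ u ⊗ v) (ev-cong-xfree X ρ≗ρ' f e₁) (ev-cong-xfree X ρ≗ρ' g e₂)
  ev-cong-xfree X ρ≗ρ' (tpsi f g)  e with ∧-true-elim {xfree X f} e
  ... | e₁ , e₂ =
    cong₂ (λ u v → fin (ψ (ωₒ ⊗ u ⊕ v))) (ev-cong-xfree X ρ≗ρ' f e₁) (ev-cong-xfree X ρ≗ρ' g e₂)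

  _[_:=1] : Subst ψ → Var → Subst ψ
  (χ [ X :=1]) Y i = if X ==ᵛ Y then tone else χ Y i

  Valid-[:=1] : ∀ X χ → Valid ψ χ → Valid ψ (χ [ X :=1])
  Valid-[:=1] X χ valid Y i i≤lv with X ==ᵛ Y
  ... | true  = b1 , ≤-refl
  ... | false = valid Y i i≤lv

  ⟦⟧-[:=1] : ∀ X χ t → xfree X t ≡ true → ⟦ t ⟧ᵒ χ ≡ ⟦ t ⟧ᵒ (χ [ X :=1])
  ⟦⟧-[:=1] X χ = ev-cong-xfree X agree
    where
    agree : ∀ Y i → (X ==ᵛ Y) ≡ false → cev ψ (χ Y i) ≡ cev ψ ((χ [ X :=1]) Y i)
    agree Y i e rewrite e = refl

  OneOn : Var → Subst ψ → Set
  OneOn X χ = ∀ Y i → (X ==ᵛ Y) ≡ true → χ Y i ≡ tone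

  OneOn-[:=1] : ∀ X χ → OneOn X (χ [ X :=1])
  OneOn-[:=1] X χ Y i e rewrite e = refl

  ⟦subst1⟧ : ∀ X χ → OneOn X χ → ∀ t → ⟦ subst1 X t ⟧ᵒ χ ≡ ⟦ t ⟧ᵒ χ
  ⟦subst1⟧ X χ one (tvar Y i) with X ==ᵛ Y in e
  ... | true  rewrite one Y i e = refl
  ... | false = refl
  ⟦subst1⟧ X χ one tzero       = refl
  ⟦subst1⟧ X χ one tone        = refl
  ⟦subst1⟧ X χ one tomega      = refl
  ⟦subst1⟧ X χ one (tplus f g) = cong₂ _⊕_ (⟦subst1⟧ X χ one f) (⟦subst1⟧ X χ one g)
  ⟦subst1⟧ X χ one (texp f g)  = cong₂ (λ u v → 2^ u ⊗ v) (⟦subst1⟧ X χ one f) (⟦subst1⟧ X χ one g)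
  ⟦subst1⟧ X χ one (tpsi f g)  =
    cong₂ (λ u v → fin (ψ (ωₒ ⊗ u ⊕ v))) (⟦subst1⟧ X χ one f) (⟦subst1⟧ X χ one g)

module NormBounds (ψ : Ord → ℕ) (isψ : IsPsi ψ) where
  open Semantics ψ
  open PsiProperties ψ isψ

  ‖tpsi‖-≥ : ∀ χ f g → ‖ f ‖ χ + ‖ g ‖ χ ≤ ‖ tpsi f g ‖ χ
  ‖tpsi‖-≥ χ f g = begin
    no u + no v                ≤⟨ +-monoˡ-≤ (no v) (no-⊗-≥ʳ ωₒ u (s≤s z≤n)) ⟩
    no (ωₒ ⊗ u) + no v         ≡⟨ sym (no-⊕ (ωₒ ⊗ u) v) ⟩
    no (ωₒ ⊗ u ⊕ v)            ≤⟨ no≤ψ (CNF-⊕ (CNF-⊗ CNF-ω (CNF-⟦⟧ f χ)) (CNF-⟦⟧ g χ)) ⟩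
    ψ (ωₒ ⊗ u ⊕ v)             ≡⟨ sym (no-fin _) ⟩
    no (fin (ψ (ωₒ ⊗ u ⊕ v)))  ∎
    where
    open ≤-Reasoning
    u = ⟦ f ⟧ᵒ χ
    v = ⟦ g ⟧ᵒ χ

  ‖texp‖-≥ˡ : ∀ χ f g → 0 < ‖ g ‖ χ → ‖ f ‖ χ ≤ 2 * ‖ texp f g ‖ χ
  ‖texp‖-≥ˡ χ f g pos =
    ≤-trans (no≤2*no-2^ (⟦ f ⟧ᵒ χ)) (*-monoʳ-≤ 2 (no-⊗-≥ˡ (2^ (⟦ f ⟧ᵒ χ)) _ pos))

  ‖texp‖-≥ʳ : ∀ χ f g → ‖ g ‖ χ ≤ ‖ texp f g ‖ χ
  ‖texp‖-≥ʳ χ f g = no-⊗-≥ʳ (2^ (⟦ f ⟧ᵒ χ)) _ (no-2^-pos (⟦ f ⟧ᵒ χ))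

  ‖tplus‖ : ∀ χ f g → ‖ tplus f g ‖ χ ≡ ‖ f ‖ χ + ‖ g ‖ χ
  ‖tplus‖ χ f g = no-⊕ (⟦ f ⟧ᵒ χ) (⟦ g ⟧ᵒ χ)

  ‖tplus‖-≥ˡ : ∀ χ f g → ‖ f ‖ χ ≤ ‖ tplus f g ‖ χ
  ‖tplus‖-≥ˡ χ f g = ≤-trans (m≤m+n _ _) (≤-reflexive (sym (‖tplus‖ χ f g)))

  ‖tplus‖-≥ʳ : ∀ χ f g → ‖ g ‖ χ ≤ ‖ tplus f g ‖ χ
  ‖tplus‖-≥ʳ χ f g = ≤-trans (m≤n+m _ _) (≤-reflexive (sym (‖tplus‖ χ f g)))

  ‖scale‖ : ∀ χ c t → ‖ scale c t ‖ χ ≡ c * ‖ t ‖ χ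
  ‖scale‖ χ zero    t = refl
  ‖scale‖ χ (suc c) t = trans (‖tplus‖ χ t (scale c t)) (cong (‖ t ‖ χ +_) (‖scale‖ χ c t))

  ‖sumT‖-≤ : ∀ {I : Set} χ {l} (is : Vec I l) (t : I → Term) (s : I → ℕ) A K →
             (∀ i → ‖ t i ‖ χ ≤ A * s i * K) → ‖ sumT (map t is) ‖ χ ≤ A * V.sum (map s is) * K
  ‖sumT‖-≤ χ []       t s A K bound = z≤n
  ‖sumT‖-≤ χ (i ∷ is) t s A K bound = begin
    ‖ sumT (map t (i ∷ is)) ‖ χ             ≡⟨ ‖tplus‖ χ (t i) (sumT (map t is)) ⟩
    ‖ t i ‖ χ + ‖ sumT (map t is) ‖ χ       ≤⟨ +-mono-≤ (bound i) (‖sumT‖-≤ χ is t s A K bound) ⟩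
    A * s i * K + A * V.sum (map s is) * K  ≡⟨ distribute A (s i) (V.sum (map s is)) K ⟩
    A * V.sum (map s (i ∷ is)) * K          ∎
    where
    open ≤-Reasoning
    distribute : ∀ A x s K → A * x * K + A * s * K ≡ A * (x + s) * K
    distribute = solve-∀

  B-pos : ∀ {i t} → B ψ i t → 0 < no (cev ψ t)
  B-pos b1 = s≤s z≤n
  B-pos bω = s≤s z≤n
  B-pos (b+ {f = f} {g} bf _) = ≤-trans (B-pos bf) (‖tplus‖-≥ˡ (λ _ _ → tzero) f g)
  B-pos (bexp {f = f} {g} _ bg) = ≤-trans (B-pos bg) (‖texp‖-≥ʳ (λ _ _ → tzero) f g)
  B-pos (bψ {f} {g} _ bg _)     = ≤-trans (B-pos bg) (≤-trans (m≤n+m _ _) (‖tpsi‖-≥ (λ _ _ → tzero) f g))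
  B-pos (blift b) = B-pos b

  C-pos : ∀ {X i t} χ → Valid ψ χ → C ψ X i t → 0 < ‖ t ‖ χ
  C-pos χ valid c1 = s≤s z≤n
  C-pos χ valid cω = s≤s z≤n
  C-pos χ valid (cvar Y i i≤lv) = B-pos (proj₁ (valid Y i i≤lv))
  C-pos χ valid (c+ {f = f} {g} cf _) = ≤-trans (C-pos χ valid cf) (‖tplus‖-≥ˡ χ f g)
  C-pos χ valid (cexp {f = f} {g} _ cg) = ≤-trans (C-pos χ valid cg) (‖texp‖-≥ʳ χ f g)
  C-pos χ valid (cψ {f} {g} _ cg _)     = ≤-trans (C-pos χ valid cg) (≤-trans (m≤n+m _ _) (‖tpsi‖-≥ χ f g))
  C-pos χ valid (clift c _) = C-pos χ valid c

get-tabulate : ∀ {k} (g : ℕ → Term) j → j < k → get (tabulate {n = k} (g ∘ toℕ)) j ≡ g j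
get-tabulate {suc k} g zero    _         = refl
get-tabulate {suc k} g (suc j) (s<s j<k) = get-tabulate (g ∘ suc) j j<k

get-replicate : ∀ {k} j → j < k → get (replicate k tone) j ≡ tone
get-replicate {suc k} zero    _         = refl
get-replicate {suc k} (suc j) (s<s j<k) = get-replicate j j<k

get-zipWith : ∀ {k} (_∙_ : Term → Term → Term) (v w : Vec Term k) j → j < k →
              get (zipWith _∙_ v w) j ≡ get v j ∙ get w j
get-zipWith _∙_ (a ∷ v) (b ∷ w) zero    _         = refl
get-zipWith _∙_ (a ∷ v) (b ∷ w) (suc j) (s<s j<k) = get-zipWith _∙_ v w j j<k

get-tabulate-lookup₂ : ∀ {k} (_∙_ : Term → Term → Term) (v w : Vec Term (suc k)) j → j < k →
  get (tabulate (λ i → lookup v (fsuc i) ∙ lookup w (fsuc i))) j ≡ get v (suc j) ∙ get w (suc j)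
get-tabulate-lookup₂ _∙_ (_ ∷ a ∷ v) (_ ∷ b ∷ w) zero    _         = refl
get-tabulate-lookup₂ _∙_ (_ ∷ a ∷ v) (_ ∷ b ∷ w) (suc j) (s<s j<k) =
  get-tabulate-lookup₂ _∙_ (a ∷ v) (b ∷ w) j j<k

lookup-get : ∀ {k} (v : Vec Term k) i → lookup v i ≡ get v (toℕ i)
lookup-get (a ∷ v) fzero    = refl
lookup-get (a ∷ v) (fsuc i) = lookup-get v i

get-tzero-or-lookup : ∀ {m} (h : Vec Term (suc m)) j →
             get h j ≡ tzero ⊎ Σ (Fin (suc m)) (λ k → toℕ k ≡ j × get h j ≡ lookup h k)
get-tzero-or-lookup (a ∷ h)       zero    = inj₂ (fzero , refl , refl)
get-tzero-or-lookup (a ∷ [])      (suc j) = inj₁ refl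
get-tzero-or-lookup (a ∷ (b ∷ h)) (suc j) with get-tzero-or-lookup (b ∷ h) j
... | inj₁ e             = inj₁ e
... | inj₂ (k , refl , e) = inj₂ (fsuc k , refl , e)

module Components (X : Var) where

  n : ℕ
  n = nX X

  δi-xfree : ∀ i h → xfree X h ≡ true → δi X i h ≡ unitAt i (tplus h tone)
  δi-xfree i (tvar Y j)  e rewrite e = refl
  δi-xfree i tzero       e = refl
  δi-xfree i tone        e = refl
  δi-xfree i tomega      e = refl
  δi-xfree i (tplus f g) e rewrite e = refl
  δi-xfree i (texp f g)  e rewrite e = refl
  δi-xfree i (tpsi f g)  e rewrite e = refl

  sz-xfree : ∀ h → xfree X h ≡ true → sz X h ≡ 1
  sz-xfree (tvar Y j)  e = refl
  sz-xfree tzero       e = refl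
  sz-xfree tone        e = refl
  sz-xfree tomega      e = refl
  sz-xfree (tplus f g) e rewrite e = refl
  sz-xfree (texp f g)  e rewrite e = refl
  sz-xfree (tpsi f g)  e rewrite e = refl

  sz-pos : ∀ h → 0 < sz X h
  sz-pos (tvar _ _) = s≤s z≤n
  sz-pos tzero      = s≤s z≤n
  sz-pos tone       = s≤s z≤n
  sz-pos tomega     = s≤s z≤n
  sz-pos (tplus f g) with xfree X (tplus f g)
  ... | true  = s≤s z≤n
  ... | false = m≤n+m 1 _
  sz-pos (texp f g) with xfree X (texp f g)
  ... | true  = s≤s z≤n
  ... | false = m≤n+m 1 _
  sz-pos (tpsi f g) with xfree X (tpsi f g)
  ... | true  = s≤s z≤n
  ... | false = m≤n+m 1 _

  get-unitAt : ∀ i t j → j < suc n → get (unitAt {suc n} i t) j ≡ (if does (j ≟ i) then t else tone)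
  get-unitAt i t = get-tabulate (λ j → if does (j ≟ i) then t else tone)

  get-unitAt-≡ : ∀ i t → i < suc n → get (unitAt {suc n} i t) i ≡ t
  get-unitAt-≡ i t i<1+n = trans (get-unitAt i t i i<1+n) (cong (if_then t else tone) (dec-true (i ≟ i) refl))

  get-unitAt-≢ : ∀ i t j → j < suc n → j ≢ i → get (unitAt {suc n} i t) j ≡ tone
  get-unitAt-≢ i t j j<1+n j≢i = trans (get-unitAt i t j j<1+n) (cong (if_then t else tone) (dec-false (j ≟ i) j≢i))

  δi-tplus : ∀ i f g j → j < suc n → xfree X (tplus f g) ≡ false →
    get (δi X i (tplus f g)) j ≡ tplus (tplus (get (δi X i f) j) (get (δi X i g) j)) tone
  δi-tplus i f g j j<n e rewrite e =
    trans (get-zipWith tplus (δi X i f +ᵛ δi X i g) ones j j<n)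
      (cong₂ tplus (get-zipWith tplus (δi X i f) (δi X i g) j j<n) (get-replicate {suc n} j j<n))

  δi-texp : ∀ i f g j → j < suc n → xfree X (texp f g) ≡ false →
    get (δi X i (texp f g)) j ≡
      tplus (tplus (tplus (get (δi X (suc i) f) j) (get (δi X (suc i) f) j)) (get (δi X i g) j)) tone
  δi-texp i f g j j<n e rewrite e = begin
    get (((Df +ᵛ Df) +ᵛ Dg) +ᵛ ones) j
      ≡⟨ get-zipWith tplus ((Df +ᵛ Df) +ᵛ Dg) ones j j<n ⟩
    tplus (get ((Df +ᵛ Df) +ᵛ Dg) j) (get (ones {suc n}) j)
      ≡⟨ cong₂ tplus (get-zipWith tplus (Df +ᵛ Df) Dg j j<n) (get-replicate {suc n} j j<n) ⟩
    tplus (tplus (get (Df +ᵛ Df) j) (get Dg j)) tone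
      ≡⟨ cong (λ t → tplus (tplus t (get Dg j)) tone) (get-zipWith tplus Df Df j j<n) ⟩
    tplus (tplus (tplus (get Df j) (get Df j)) (get Dg j)) tone ∎
    where
    open ≡-Reasoning
    Df = δi X (suc i) f
    Dg = δi X i g

  δ₀₀ : Term → Term
  δ₀₀ h = get (δi X 0 h) 0

  δ₀₀-tpsi : ∀ f g → xfree X (tpsi f g) ≡ false →
    δ₀₀ (tpsi f g) ≡ tpsi (subst1 X f) (δ₀₀ g)
  δ₀₀-tpsi f g e rewrite e = cong (tpsi (subst1 X f)) (lookup-get (δi X 0 g) fzero)

  δ₀-tpsi-suc : ∀ f g j → j < n → xfree X (tpsi f g) ≡ false →
    get (δi X 0 (tpsi f g)) (suc j) ≡ tplus (get (δi X 1 f) (suc j)) (get (δi X 0 g) (suc j))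
  δ₀-tpsi-suc f g j j<n e rewrite e = get-tabulate-lookup₂ tplus (δi X 1 f) (δi X 0 g) j j<n

  sz-tplus : ∀ f g → xfree X (tplus f g) ≡ false → sz X (tplus f g) ≡ sz X f + sz X g + 1
  sz-tplus f g e rewrite e = refl

  sz-texp : ∀ f g → xfree X (texp f g) ≡ false → sz X (texp f g) ≡ 2 * sz X f + sz X g + 1
  sz-texp f g e rewrite e = refl

  sz-tpsi : ∀ f g → xfree X (tpsi f g) ≡ false → sz X (tpsi f g) ≡ sz X f + sz X g + 1
  sz-tpsi f g e rewrite e = refl

  xfree-scale : ∀ c t → xfree X t ≡ true → xfree X (scale c t) ≡ true
  xfree-scale zero    t free = refl
  xfree-scale (suc c) t free = ∧-true-intro free (xfree-scale c t free)

  xfree-sumT : ∀ {I : Set} {l} (is : Vec I l) (t : I → Term) →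
               (∀ i → xfree X (t i) ≡ true) → xfree X (sumT (map t is)) ≡ true
  xfree-sumT []       t free = refl
  xfree-sumT (i ∷ is) t free = ∧-true-intro (free i) (xfree-sumT is t free)

  record AllXFree {k} (v : Vec Term k) : Set where
    constructor all-xfree
    field lookup-xfree : ∀ i → xfree X (lookup v i) ≡ true
  open AllXFree

  AllXFree-get : ∀ {k} {v : Vec Term k} → AllXFree v → ∀ j → xfree X (get v j) ≡ true
  AllXFree-get {v = []}    _    j       = refl
  AllXFree-get {v = _ ∷ _} free zero    = lookup-xfree free fzero
  AllXFree-get {v = _ ∷ v} free (suc j) = AllXFree-get {v = v} (all-xfree (lookup-xfree free ∘ fsuc)) j

  AllXFree-ones : ∀ {k} → AllXFree (ones {k})
  AllXFree-ones = all-xfree λ i → cong (xfree X) (lookup-replicate i tone)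

  AllXFree-+ᵛ : ∀ {k} {v w : Vec Term k} → AllXFree v → AllXFree w → AllXFree (v +ᵛ w)
  AllXFree-+ᵛ {v = v} {w} free-v free-w = all-xfree λ i →
    trans (cong (xfree X) (lookup-zipWith tplus i v w))
          (∧-true-intro (lookup-xfree free-v i) (lookup-xfree free-w i))

  AllXFree-tabulate : ∀ {k} {t : Fin k → Term} → (∀ i → xfree X (t i) ≡ true) → AllXFree (tabulate t)
  AllXFree-tabulate {t = t} free = all-xfree λ i → trans (cong (xfree X) (lookup∘tabulate t i)) (free i)

  AllXFree-unitAt : ∀ i t → xfree X t ≡ true → AllXFree (unitAt {suc n} i t)
  AllXFree-unitAt i t free =
    AllXFree-tabulate {t = λ j → if does (toℕ j ≟ i) then t else tone} λ j → if-xfree (does (toℕ j ≟ i))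
    where
    if-xfree : ∀ b → xfree X (if b then t else tone) ≡ true
    if-xfree true  = free
    if-xfree false = refl

  AllXFree-δi : ∀ i h → AllXFree (δi X i h)
  AllXFree-δi i h with xfree X h in e
  ... | true rewrite δi-xfree i h e = AllXFree-unitAt i (tplus h tone) (∧-true-intro e refl)
  ... | false = x-dependent i h e
    where
    x-dependent : ∀ i h → xfree X h ≡ false → AllXFree (δi X i h)
    x-dependent i (tvar Y j)  e rewrite e = AllXFree-ones
    x-dependent i (tplus f g) e rewrite e =
      AllXFree-+ᵛ (AllXFree-+ᵛ (AllXFree-δi i f) (AllXFree-δi i g)) AllXFree-ones
    x-dependent i (texp f g)  e rewrite e =
      AllXFree-+ᵛ (AllXFree-+ᵛ (AllXFree-+ᵛ (AllXFree-δi (suc i) f) (AllXFree-δi (suc i) f)) (AllXFree-δi i g))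
        AllXFree-ones
    x-dependent i (tpsi f g)  e = all-xfree (component e)
      where
      component : xfree X (tpsi f g) ≡ false → ∀ j → xfree X (lookup (δi X i (tpsi f g)) j) ≡ true
      component e fzero    rewrite e = ∧-true-intro (xfree-subst1 X f) (lookup-xfree (AllXFree-δi 0 g) fzero)
      component e (fsuc j) rewrite e =
        trans (cong (xfree X) (lookup∘tabulate (λ j → tplus (lookup Df (fsuc j)) (lookup Dg (fsuc j))) j))
              (∧-true-intro (lookup-xfree (AllXFree-δi 1 f) (fsuc j)) (lookup-xfree (AllXFree-δi 0 g) (fsuc j)))
        where
        Df = δi X 1 f
        Dg = δi X 0 g

-- Norm estimates for δ

-- The weight of level i: it halves from each level to the next (the texp case), levels 0 and 1
-- share it (the tpsi case), it is at least 2 at the levels 1, …, n (the x-free case h ↦ h + 1)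
-- and at most 2^n.
weight : ℕ → ℕ → ℕ
weight n zero    = 2 ^ n
weight n (suc i) = 2 ^ (n ∸ i)

weight-pos : ∀ n i → 0 < weight n i
weight-pos n zero    = m^n>0 2 n
weight-pos n (suc i) = m^n>0 2 (n ∸ i)

weight-≤ : ∀ n i → weight n i ≤ 2 ^ n
weight-≤ n zero    = ≤-refl
weight-≤ n (suc i) = ^-monoʳ-≤ 2 (m∸n≤m n i)

weight-halves : ∀ n i → i < n → weight n (suc i) ≡ 2 * weight n (suc (suc i))
weight-halves n i i<n = cong (2 ^_) (+-∸-assoc 1 i<n)

weight-≥2 : ∀ n i → i < n → 2 ≤ weight n (suc i)
weight-≥2 n i i<n rewrite weight-halves n i i<n = *-monoʳ-≤ 2 (weight-pos n (suc (suc i)))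

*-pos : ∀ {a b} → 0 < a → 0 < b → 0 < a * b
*-pos {suc a} {suc b} _ _ = s≤s z≤n

≤-*-weaken : ∀ {A a N} c → A ≤ c * a → a ≤ N → A ≤ c * N
≤-*-weaken c A≤ca a≤N = ≤-trans A≤ca (*-monoʳ-≤ c a≤N)

one-bound : ∀ {w N} → 0 < w → 0 < N → 1 ≤ w * 1 * N
one-bound w>0 N>0 = *-pos (*-pos w>0 (s≤s z≤n)) N>0

succ-bound : ∀ {w N} → 2 ≤ w → 0 < N → N + 1 ≤ w * 1 * N
succ-bound {w} {N} w≥2 N>0 = begin
  N + 1     ≤⟨ +-monoʳ-≤ N N>0 ⟩
  N + N     ≡⟨ cong (N +_) (sym (+-identityʳ N)) ⟩
  2 * N     ≤⟨ *-monoˡ-≤ N w≥2 ⟩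
  w * N     ≡⟨ cong (_* N) (sym (*-identityʳ w)) ⟩
  w * 1 * N ∎
  where open ≤-Reasoning

sum-bound : ∀ w sf sg {A B a b N} → A ≤ w * sf * a → B ≤ w * sg * b → a ≤ N → b ≤ N →
            A + B + w * N ≤ w * (sf + sg + 1) * N
sum-bound w sf sg {A} {B} {N = N} A≤ B≤ a≤N b≤N = begin
  A + B + w * N
    ≤⟨ +-monoˡ-≤ (w * N) (+-mono-≤ (≤-*-weaken (w * sf) A≤ a≤N) (≤-*-weaken (w * sg) B≤ b≤N)) ⟩
  w * sf * N + w * sg * N + w * N  ≡⟨ distribute w sf sg N ⟩
  w * (sf + sg + 1) * N            ∎
  where
  open ≤-Reasoning
  distribute : ∀ w sf sg N → w * sf * N + w * sg * N + w * N ≡ w * (sf + sg + 1) * N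
  distribute = solve-∀

exp-bound : ∀ {A B a b w w' sf sg N} → w ≡ 2 * w' →
            A ≤ w' * sf * a → B ≤ w * sg * b → a ≤ 2 * N → b ≤ N → 0 < N → 0 < w' →
            A + A + B + 1 ≤ w * (2 * sf + sg + 1) * N
exp-bound {A} {B} {w' = w} {sf = sf} {sg} {N} refl A≤ B≤ a≤2N b≤N N>0 w>0 = begin
  A + A + B + 1
    ≤⟨ +-mono-≤ (+-mono-≤ (+-mono-≤ A≤' A≤') (≤-*-weaken (2 * w * sg) B≤ b≤N))
                (*-pos (*-pos {2} (s≤s z≤n) w>0) N>0) ⟩
  w * sf * (2 * N) + w * sf * (2 * N) + 2 * w * sg * N + 2 * w * N
    ≡⟨ distribute w sf sg N ⟩
  2 * w * (2 * sf + sg + 1) * N ∎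
  where
  open ≤-Reasoning
  A≤' = ≤-*-weaken (w * sf) A≤ a≤2N
  distribute : ∀ w sf sg N →
    w * sf * (2 * N) + w * sf * (2 * N) + 2 * w * sg * N + 2 * w * N ≡ 2 * w * (2 * sf + sg + 1) * N
  distribute = solve-∀

module Estimates (ψ : Ord → ℕ) (isψ : IsPsi ψ) (X : Var) where
  open Semantics ψ
  open PsiProperties ψ isψ
  open NormBounds ψ isψ
  open Components X

  level-of-x-dependent : ∀ {i h} → C ψ X i h → xfree X h ≡ false → i ≤ lvV X
  level-of-x-dependent (cvar Y i i≤lv) e = subst (i ≤_) (sym (==ᵛ⇒lvV≡ X Y (not-false-elim e))) i≤lv
  level-of-x-dependent (c+ {f = f} cf cg) e with ∧-false-elim {xfree X f} e
  ... | inj₁ e₁ = level-of-x-dependent cf e₁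
  ... | inj₂ e₂ = level-of-x-dependent cg e₂
  level-of-x-dependent (cexp {f = f} cf cg) e with ∧-false-elim {xfree X f} e
  ... | inj₁ e₁ = ≤-trans (n≤1+n _) (level-of-x-dependent cf e₁)
  ... | inj₂ e₂ = level-of-x-dependent cg e₂
  level-of-x-dependent (cψ _ _ _) e = z≤n
  level-of-x-dependent (clift _ e') e = ⊥-elim (true≢false (trans (sym e') e))

  xfree-above-level : ∀ {i h} → C ψ X i h → lvV X < i → xfree X h ≡ true
  xfree-above-level {i} {h} c lv<i with xfree X h in e
  ... | true  = refl
  ... | false = ⊥-elim (<⇒≱ lv<i (level-of-x-dependent c e))

  module _ (χ : Subst ψ) (valid : Valid ψ χ) where

    ‖δi‖-≤ : ∀ {i h} → C ψ X i h → ∀ j → j < n →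
             ‖ get (δi X i h) (suc j) ‖ χ ≤ weight n i * sz X h * ‖ h ‖ χ
    ‖δi‖-≤-x-dependent : ∀ {i h} → C ψ X i h → xfree X h ≡ false → ∀ j → j < n →
                       ‖ get (δi X i h) (suc j) ‖ χ ≤ weight n i * sz X h * ‖ h ‖ χ

    ‖δi‖-≤ {i} {h} c j j<n with xfree X h in e
    ... | false = ‖δi‖-≤-x-dependent c e j j<n
    ... | true rewrite δi-xfree i h e | sz-xfree h e with suc j ≟ i
    ...   | false because ofⁿ j≢i rewrite get-unitAt-≢ i (tplus h tone) (suc j) (s≤s j<n) j≢i =
      one-bound (weight-pos n i) (C-pos χ valid c)
    ...   | true because ofʸ refl rewrite get-unitAt-≡ (suc j) (tplus h tone) (s≤s j<n) | ‖tplus‖ χ h tone =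
      succ-bound (weight-≥2 n j j<n) (C-pos χ valid c)

    ‖δi‖-≤-x-dependent c@(cvar Y i _) e j j<n rewrite e | get-replicate {suc n} (suc j) (s≤s j<n) =
      one-bound (weight-pos n i) (C-pos χ valid c)
    ‖δi‖-≤-x-dependent {i} c@(c+ {f = f} {g} cf cg) e j j<n = begin
      ‖ get (δi X i (tplus f g)) (suc j) ‖ χ ≡⟨ cong (‖_‖ χ) (δi-tplus i f g (suc j) (s≤s j<n) e) ⟩
      ‖ tplus (tplus Df Dg) tone ‖ χ         ≡⟨ trans (‖tplus‖ χ (tplus Df Dg) tone)
                                                      (cong (_+ 1) (‖tplus‖ χ Df Dg)) ⟩
      ‖ Df ‖ χ + ‖ Dg ‖ χ + 1                ≤⟨ +-monoʳ-≤ _ (*-pos (weight-pos n i) (C-pos χ valid c)) ⟩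
      ‖ Df ‖ χ + ‖ Dg ‖ χ + weight n i * N   ≤⟨ sum-bound (weight n i) (sz X f) (sz X g)
                                                  (‖δi‖-≤ cf j j<n) (‖δi‖-≤ cg j j<n)
                                                  (‖tplus‖-≥ˡ χ f g) (‖tplus‖-≥ʳ χ f g) ⟩
      weight n i * (sz X f + sz X g + 1) * N ≡⟨ cong (λ s → weight n i * s * N) (sym (sz-tplus f g e)) ⟩
      weight n i * sz X (tplus f g) * N      ∎
      where
      open ≤-Reasoning
      Df = get (δi X i f) (suc j)
      Dg = get (δi X i g) (suc j)
      N = ‖ tplus f g ‖ χ
    ‖δi‖-≤-x-dependent {suc i} c@(cexp {f = f} {g} cf cg) e j j<n = begin
      ‖ get (δi X (suc i) (texp f g)) (suc j) ‖ χ ≡⟨ cong (‖_‖ χ) (δi-texp (suc i) f g (suc j) (s≤s j<n) e) ⟩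
      ‖ tplus (tplus (tplus Df Df) Dg) tone ‖ χ   ≡⟨ trans (‖tplus‖ χ (tplus (tplus Df Df) Dg) tone)
                                                      (cong (_+ 1) (trans (‖tplus‖ χ (tplus Df Df) Dg)
                                                                          (cong (_+ ‖ Dg ‖ χ) (‖tplus‖ χ Df Df)))) ⟩
      ‖ Df ‖ χ + ‖ Df ‖ χ + ‖ Dg ‖ χ + 1
        ≤⟨ exp-bound (weight-halves n i (m≤n⇒m≤1+n (level-of-x-dependent c e)))
             (‖δi‖-≤ cf j j<n) (‖δi‖-≤ cg j j<n)
             (‖texp‖-≥ˡ χ f g (C-pos χ valid cg)) (‖texp‖-≥ʳ χ f g)
             (C-pos χ valid c) (weight-pos n (suc (suc i))) ⟩
      weight n (suc i) * (2 * sz X f + sz X g + 1) * N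
        ≡⟨ cong (λ s → weight n (suc i) * s * N) (sym (sz-texp f g e)) ⟩
      weight n (suc i) * sz X (texp f g) * N      ∎
      where
      open ≤-Reasoning
      Df = get (δi X (suc (suc i)) f) (suc j)
      Dg = get (δi X (suc i) g) (suc j)
      N = ‖ texp f g ‖ χ
    ‖δi‖-≤-x-dependent (cψ {f} {g} cf cg _) e j j<n = begin
      ‖ get (δi X 0 (tpsi f g)) (suc j) ‖ χ  ≡⟨ cong (‖_‖ χ) (δ₀-tpsi-suc f g j j<n e) ⟩
      ‖ tplus Df Dg ‖ χ                      ≡⟨ ‖tplus‖ χ Df Dg ⟩
      ‖ Df ‖ χ + ‖ Dg ‖ χ                    ≤⟨ m≤m+n _ _ ⟩
      ‖ Df ‖ χ + ‖ Dg ‖ χ + weight n 0 * N   ≤⟨ sum-bound (weight n 0) (sz X f) (sz X g)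
                                                  (‖δi‖-≤ cf j j<n) (‖δi‖-≤ cg j j<n)
                                                  (≤-trans (m≤m+n _ _) (‖tpsi‖-≥ χ f g))
                                                  (≤-trans (m≤n+m _ _) (‖tpsi‖-≥ χ f g)) ⟩
      weight n 0 * (sz X f + sz X g + 1) * N ≡⟨ cong (λ s → weight n 0 * s * N) (sym (sz-tpsi f g e)) ⟩
      weight n 0 * sz X (tpsi f g) * N       ∎
      where
      open ≤-Reasoning
      Df = get (δi X 1 f) (suc j)
      Dg = get (δi X 0 g) (suc j)
      N = ‖ tpsi f g ‖ χ
    ‖δi‖-≤-x-dependent (clift _ e') e _ _ = ⊥-elim (true≢false (trans (sym e') e))

  -- With the variables of X set to 1, as δ₀ does inside ψ, δ₀ can only make a level-0 term larger.
  module _ (χ : Subst ψ) (one : OneOn X χ) where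

    δ₀₀-≽ : ∀ {h} → C ψ X 0 h → ⟦ h ⟧ᵒ χ ≼ ⟦ δ₀₀ h ⟧ᵒ χ
    δ₀₀-≽-x-dependent : ∀ {h} → C ψ X 0 h → xfree X h ≡ false → ⟦ h ⟧ᵒ χ ≼ ⟦ δ₀₀ h ⟧ᵒ χ

    δ₀₀-≽ {h} c with xfree X h in e
    ... | false = δ₀₀-≽-x-dependent c e
    ... | true rewrite δi-xfree 0 h e = ≼-⊕ʳ (CNF-⟦⟧ h χ) (CNF-fin 1)

    δ₀₀-≽-x-dependent (cvar Y i _) e rewrite e | one Y i (not-false-elim e) = ≼-refl
    δ₀₀-≽-x-dependent (c+ {f = f} {g} cf cg) e rewrite δi-tplus 0 f g 0 (s≤s z≤n) e =
      ≼-trans (⊕-mono-≼ (CNF-⟦⟧ f χ) (CNF-⟦⟧ (δ₀₀ f) χ) (CNF-⟦⟧ g χ) (CNF-⟦⟧ (δ₀₀ g) χ)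
                        (δ₀₀-≽ cf) (δ₀₀-≽ cg))
              (≼-⊕ʳ (CNF-⊕ (CNF-⟦⟧ (δ₀₀ f) χ) (CNF-⟦⟧ (δ₀₀ g) χ)) (CNF-fin 1))
    δ₀₀-≽-x-dependent (cψ {f} {g} cf cg _) e rewrite δ₀₀-tpsi f g e | ⟦subst1⟧ X χ one f =
      fin-mono-≼ (ψ-mono (CNF-⊕ ωf (CNF-⟦⟧ g χ)) (CNF-⊕ ωf (CNF-⟦⟧ (δ₀₀ g) χ))
        (⊕-mono-≼ ωf ωf (CNF-⟦⟧ g χ) (CNF-⟦⟧ (δ₀₀ g) χ) ≼-refl (δ₀₀-≽ cg)))
      where
      ωf = CNF-⊗ CNF-ω (CNF-⟦⟧ f χ)
    δ₀₀-≽-x-dependent (clift _ e') e = ⊥-elim (true≢false (trans (sym e') e))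

if-dec : ∀ {A : Set} {P : Term → Set} {a c} (d : Dec A) →
         (A → P a) → (¬ A → P c) → P (if does d then a else c)
if-dec (true  because ofʸ p)  pa pc = pa p
if-dec (false because ofⁿ ¬p) pa pc = pc ¬p

module DeltaVector (ψ : Ord → ℕ) (isψ : IsPsi ψ) (X : Var) {m : ℕ} (h : Vec Term (suc m))
                   (h∈C : InC ψ X h) (bounded : BoundedNorm ψ h) where
  open Semantics ψ
  open NormBounds ψ isψ
  open Components X
  open Estimates ψ isψ X

  h₀ : Term
  h₀ = lookup h fzero

  size : ℕ
  size = V.sum (map (λ i → sz X (lookup h i)) (allFin (suc m)))

  D₀ : Term
  D₀ = lookup (δi X 0 h₀) fzero

  -- the component (δvec X h)₀, by the definition of δvec
  head : Term
  head = scale (2 ^ n * size) D₀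

  summand : ℕ → Fin (suc m) → Term
  summand j i = get (δi X (toℕ i) (lookup h i)) (suc j)

  xfree-head : xfree X head ≡ true
  xfree-head = xfree-scale (2 ^ n * size) D₀ (AllXFree.lookup-xfree (AllXFree-δi 0 h₀) fzero)

  module _ (χ : Subst ψ) (valid : Valid ψ χ) where

    χ₁ : Subst ψ
    χ₁ = χ [ X :=1]

    valid₁ : Valid ψ χ₁
    valid₁ = Valid-[:=1] X χ valid

    -- The components of δvec X h are x-free, so they may be evaluated under χ₁, where δ₀₀-≽ applies.
    ≤‖head‖ : ∀ t → xfree X t ≡ true → ‖ t ‖ χ₁ ≤ ‖ head ‖ χ₁ → ‖ t ‖ χ ≤ ‖ head ‖ χ
    ≤‖head‖ t free t≤ =
      subst₂ _≤_ (cong no (sym (⟦⟧-[:=1] X χ t free))) (cong no (sym (⟦⟧-[:=1] X χ head xfree-head))) t≤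

    ‖h₀‖≤‖D₀‖ : ‖ h₀ ‖ χ₁ ≤ ‖ D₀ ‖ χ₁
    ‖h₀‖≤‖D₀‖ = subst (λ t → ‖ h₀ ‖ χ₁ ≤ ‖ t ‖ χ₁) (sym (lookup-get (δi X 0 h₀) fzero))
                         (proj₂ (δ₀₀-≽ χ₁ (OneOn-[:=1] X χ) (h∈C fzero)))

    ‖sum‖-≤ : ∀ j → j < n → ‖ sumT (map (summand j) (allFin (suc m))) ‖ χ ≤ ‖ head ‖ χ
    ‖sum‖-≤ j j<n = ≤‖head‖ (sumT (map (summand j) (allFin (suc m))))
      (xfree-sumT (allFin (suc m)) (summand j) (λ i → AllXFree-get (AllXFree-δi (toℕ i) (lookup h i)) (suc j))) (begin
      ‖ sumT (map (summand j) (allFin (suc m))) ‖ χ₁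
        ≤⟨ ‖sumT‖-≤ χ₁ (allFin (suc m)) (summand j) (λ i → sz X (lookup h i)) (2 ^ n) (‖ h₀ ‖ χ₁)
                    term-≤ ⟩
      2 ^ n * size * ‖ h₀ ‖ χ₁
        ≤⟨ *-monoʳ-≤ (2 ^ n * size) ‖h₀‖≤‖D₀‖ ⟩
      2 ^ n * size * ‖ D₀ ‖ χ₁
        ≡⟨ sym (‖scale‖ χ₁ (2 ^ n * size) D₀) ⟩
      ‖ head ‖ χ₁ ∎)
      where
      open ≤-Reasoning
      term-≤ : ∀ i → ‖ summand j i ‖ χ₁ ≤ 2 ^ n * sz X (lookup h i) * ‖ h₀ ‖ χ₁
      term-≤ i = ≤-trans (‖δi‖-≤ χ₁ valid₁ (h∈C i) j j<n)
        (*-mono-≤ (*-monoˡ-≤ (sz X (lookup h i)) (weight-≤ n (toℕ i))) (bounded i χ₁ valid₁))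

    ‖get-h‖-≤ : ∀ j → ¬ (suc j ≤ n) → ‖ get h (suc j) ‖ χ ≤ ‖ head ‖ χ
    ‖get-h‖-≤ j j≮n with get-tzero-or-lookup h (suc j)
    ... | inj₁ e rewrite e = z≤n
    ... | inj₂ (k , k≡ , e) rewrite e = ≤‖head‖ (lookup h k) hₖ-xfree (begin
      ‖ lookup h k ‖ χ₁         ≤⟨ bounded k χ₁ valid₁ ⟩
      ‖ h₀ ‖ χ₁                 ≤⟨ ‖h₀‖≤‖D₀‖ ⟩
      ‖ D₀ ‖ χ₁                 ≤⟨ m≤n*m _ (2 ^ n * size) {{>-nonZero (*-pos (m^n>0 2 n) size-pos)}} ⟩
      2 ^ n * size * ‖ D₀ ‖ χ₁  ≡⟨ sym (‖scale‖ χ₁ (2 ^ n * size) D₀) ⟩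
      ‖ head ‖ χ₁               ∎)
      where
      open ≤-Reasoning
      hₖ-xfree : xfree X (lookup h k) ≡ true
      hₖ-xfree = xfree-above-level (h∈C k) (subst (lvV X <_) (sym k≡) (≤-trans (n≤1+n _) (≰⇒> j≮n)))
      size-pos : 0 < size
      size-pos = ≤-trans (sz-pos h₀) (m≤m+n _ _)

lemma2p21 : (ψ : Ord → ℕ) → IsPsi ψ →
    (X : Var) → ∀ {m} → (h : Vec Term (suc m)) →
    InC ψ X h → BoundedNorm ψ h → BoundedNorm ψ (δvec X h)
lemma2p21 ψ isψ X h h∈C bounded fzero    χ valid = ≤-refl
lemma2p21 ψ isψ X h h∈C bounded (fsuc k) χ valid =
  subst (λ t → ‖ t ‖ χ ≤ ‖ head ‖ χ) (sym (lookup∘tabulate _ k))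
    (if-dec {P = λ t → ‖ t ‖ χ ≤ ‖ head ‖ χ} (suc (toℕ k) ≤? n)
      (‖sum‖-≤ χ valid (toℕ k)) (‖get-h‖-≤ χ valid (toℕ k)))
  where
  open Semantics ψ
  open Components X
  open DeltaVector ψ isψ X h h∈C bounded
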